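{- Let $k\in\mathbb{Z}_{\ge1}$. Let $M$ be a simple matroid with a set $X\subseteq E(M)$ such that $M|X\cong M(K_{r(M)+1})$, and let $B\subseteq X$ be a frame for $M|X$. Suppose there is a set $B'\subseteq B$ such that every element of $E(M)-X$ is a loop of $M/B'$ or is parallel in $M/B'$ to an element of $B-B'$, and that each element of $B-B'$ is parallel in $M/B'$ to at most $k$ elements of $E(M)-X$. Then the number of $k$-local-critical elements of $M$ is at most $|\operatorname{cl}(B')|$.
   Context: $M(K_{m})$ is the cycle matroid of the complete graph on $m$ vertices; a frame for it is a basis $B$ such that each element is spanned by a subset of $B$ of size at most two. A point of a matroid is a maximal rank-1 set of elements and $\varepsilon(M)$ is the number of points of $M$. A line is a maximal rank-2 set and a long line is a line containing at least three points. For an element $e$ of $M$ and $k\in\mathbb{Z}_{\ge0}$, let $N$ be the restriction of $M$ to the union of all long lines of $M$ through $e$; then $e$ is $k$-local-critical if $\varepsilon(N)-\varepsilon(N/e)>r(N)+k$. $\operatorname{cl}$ denotes closure in $M$. -}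

module Defs where

open import Data.Nat using (ℕ; zero; suc; _+_; _∸_; _≤_; _<_; _≟_; _<?_)
open import Data.Nat.Properties using (_≤?_)
open import Data.Bool using (true; false)
open import Data.Fin as F using (Fin; fromℕ; inject₁)
open import Data.Fin.Subset using (Subset; _∈_; _∉_; _⊆_; _∪_; ⁅_⁆; ⊤; ⋃; ∣_∣)
open import Data.Fin.Subset.Properties using (_∈?_; _⊆?_)
open import Data.Vec using (_∷_; []; tabulate)
open import Data.List using (List; _++_; map; filter; length) renaming ([] to []ₗ; _∷_ to _∷ₗ_)
import Data.List.Membership.Propositional as LM
open import Data.List.Membership.Propositional.Properties using (∈-map⁺; ∈-++⁺ˡ; ∈-++⁺ʳ)
open import Data.List.Relation.Unary.All as All using (All; all?)
open import Data.List.Relation.Unary.Any as Any using (Any; any?; here; there)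
open import Data.Product using (Σ; ∃; _×_; _,_; proj₁; proj₂)
open import Data.Sum using (_⊎_)
open import Relation.Nullary using (Dec; yes; no; ¬_; does)
open import Relation.Nullary.Decidable using (_×-dec_; _⊎-dec_; ¬?)
open import Relation.Unary using (Decidable)
open import Relation.Binary.PropositionalEquality using (_≡_; _≢_; refl)
open import Function using (Injective)

allSubsets : ∀ n → List (Subset n)
allSubsets zero = [] ∷ₗ []ₗ
allSubsets (suc n) = map (true ∷_) (allSubsets n) ++ map (false ∷_) (allSubsets n)

allSubsets-complete : ∀ {n} (s : Subset n) → s LM.∈ allSubsets n
allSubsets-complete [] = here refl
allSubsets-complete {suc n} (true ∷ s) = ∈-++⁺ˡ (∈-map⁺ (true ∷_) (allSubsets-complete s))
allSubsets-complete {suc n} (false ∷ s) =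
  ∈-++⁺ʳ (map (true ∷_) (allSubsets n)) (∈-map⁺ (false ∷_) (allSubsets-complete s))

module _ {n : ℕ} {P : Subset n → Set} (P? : Decidable P) where
  ∀Sub? : Dec (∀ s → P s)
  ∀Sub? with all? P? (allSubsets n)
  ... | yes a = yes (λ s → All.lookup a (allSubsets-complete s))
  ... | no ¬a = no (λ f → ¬a (All.tabulate (λ {s} _ → f s)))

  ∃Sub? : Dec (∃ P)
  ∃Sub? with any? P? (allSubsets n)
  ... | yes a = yes (Any.satisfied a)
  ... | no ¬a = no (λ { (s , p) → ¬a (Any.map (λ { refl → p }) (allSubsets-complete s)) })

  #Subsets : ℕ
  #Subsets = length (filter P? (allSubsets n))

⟦_⟧ : ∀ {n} {P : Fin n → Set} → Decidable P → Subset n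
⟦ P? ⟧ = tabulate (λ i → does (P? i))

record Matroid (n : ℕ) : Set where
  field
    r        : Subset n → ℕ
    r-bound  : ∀ X → r X ≤ ∣ X ∣
    r-mono   : ∀ {X Y} → X ⊆ Y → r X ≤ r Y
    r-submod : ∀ X Y → r (X ∪ Y) + r (Data.Fin.Subset._∩_ X Y) ≤ r X + r Y

module _ {n : ℕ} (M : Matroid n) where
  open Matroid M

  rankM : ℕ
  rankM = r ⊤

  Independent : Subset n → Set
  Independent Y = r Y ≡ ∣ Y ∣

  Simple : Set
  Simple = (∀ e → r ⁅ e ⁆ ≡ 1) × (∀ e f → e ≢ f → r (⁅ e ⁆ ∪ ⁅ f ⁆) ≡ 2)

  cl : Subset n → Subset n
  cl Y = ⟦ (λ e → r (Y ∪ ⁅ e ⁆) ≟ r Y) ⟧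

  IsBasisOfRestriction : Subset n → Subset n → Set
  IsBasisOfRestriction X B =
    B ⊆ X × Independent B ×
    (∀ Y → B ⊆ Y → Y ⊆ X → Independent Y → Y ⊆ B)

  IsFrame : Subset n → Subset n → Set
  IsFrame X B = IsBasisOfRestriction X B ×
    (∀ e → e ∈ X → ∃ λ S → S ⊆ B × ∣ S ∣ ≤ 2 × r (S ∪ ⁅ e ⁆) ≡ r S)

  rc : Subset n → Subset n → ℕ
  rc C Y = r (Y ∪ C) ∸ r C

  LoopIn/ : Subset n → Fin n → Set
  LoopIn/ C e = rc C ⁅ e ⁆ ≡ 0

  ParallelIn/ : Subset n → Fin n → Fin n → Set
  ParallelIn/ C e f = e ≢ f × rc C ⁅ e ⁆ ≡ 1 × rc C ⁅ f ⁆ ≡ 1 × rc C (⁅ e ⁆ ∪ ⁅ f ⁆) ≡ 1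

  ParallelIn/? : ∀ C e f → Dec (ParallelIn/ C e f)
  ParallelIn/? C e f = ¬? (e F.≟ f) ×-dec (rc C ⁅ e ⁆ ≟ 1) ×-dec (rc C ⁅ f ⁆ ≟ 1)
                         ×-dec (rc C (⁅ e ⁆ ∪ ⁅ f ⁆) ≟ 1)

  -- Points of a matroid with ground set Z ⊆ Fin n and rank function ρ
  -- (ρ is only consulted on subsets of Z): maximal rank-1 subsets of Z.

  IsPointOf : (Subset n → ℕ) → Subset n → Subset n → Set
  IsPointOf ρ Z P = P ⊆ Z × ρ P ≡ 1 × (∀ Q → Q ⊆ Z → P ⊆ Q → ρ Q ≡ 1 → Q ⊆ P)

  IsPointOf? : ∀ ρ Z → Decidable (IsPointOf ρ Z)
  IsPointOf? ρ Z P = (P ⊆? Z) ×-dec (ρ P ≟ 1) ×-dec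
    ∀Sub? (λ Q → imp (Q ⊆? Z) (imp (P ⊆? Q) (imp (ρ Q ≟ 1) (Q ⊆? P))))
    where
    imp : ∀ {A B : Set} → Dec A → Dec B → Dec (A → B)
    imp (yes a) (yes b) = yes (λ _ → b)
    imp (yes a) (no ¬b) = no (λ f → ¬b (f a))
    imp (no ¬a) _ = yes (λ a → Data.Empty.⊥-elim (¬a a))
      where import Data.Empty

  ε : (Subset n → ℕ) → Subset n → ℕ
  ε ρ Z = #Subsets (IsPointOf? ρ Z)

  IsLine : Subset n → Set
  IsLine L = r L ≡ 2 × (∀ Q → L ⊆ Q → r Q ≡ 2 → Q ⊆ L)

  IsLongLineThrough : Fin n → Subset n → Set
  IsLongLineThrough e L = IsLine L × e ∈ L × 3 ≤ ε r L

  IsLongLineThrough? : ∀ e → Decidable (IsLongLineThrough e)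
  IsLongLineThrough? e L =
    ((r L ≟ 2) ×-dec ∀Sub? (λ Q → imp (L ⊆? Q) (imp (r Q ≟ 2) (Q ⊆? L))))
      ×-dec (e ∈? L) ×-dec (3 ≤? ε r L)
    where
    imp : ∀ {A B : Set} → Dec A → Dec B → Dec (A → B)
    imp (yes a) (yes b) = yes (λ _ → b)
    imp (yes a) (no ¬b) = no (λ f → ¬b (f a))
    imp (no ¬a) _ = yes (λ a → Data.Empty.⊥-elim (¬a a))
      where import Data.Empty

  longLineUnion : Fin n → Subset n
  longLineUnion e = ⋃ (filter (IsLongLineThrough? e) (allSubsets n))

  -- e is k-local-critical:  ε(N) - ε(N/e) > r(N) + k,
  -- where N = M | longLineUnion e, and N/e has ground set Z - {e}
  -- and rank Y ↦ r(Y ∪ {e}) - r({e}).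
  LocalCritical : ℕ → Fin n → Set
  LocalCritical k e =
    let Z = longLineUnion e in
    ε (rc ⁅ e ⁆) (Data.Fin.Subset._-_ Z e) + (r Z + k) < ε r Z

  LocalCritical? : ∀ k → Decidable (LocalCritical k)
  LocalCritical? k e = _ <? _

  #LocalCritical : ℕ → ℕ
  #LocalCritical k = ∣ ⟦ LocalCritical? k ⟧ ∣

-- Edges of K_m are pairs (i , j) with i < j.  A cycle of length l+3 is an injective vertex sequence
-- c : Fin (l+3) → Fin m with consecutive (cyclically) vertices adjacent.

EdgeSet : ℕ → Set₁
EdgeSet m = Fin m → Fin m → Set

Adjacent : ∀ {m} → EdgeSet m → Fin m → Fin m → Set
Adjacent S u v = S u v ⊎ S v u

HasCycle : ∀ {m} → EdgeSet m → Set
HasCycle {m} S = ∃ λ l → Σ (Fin (suc (suc (suc l))) → Fin m) λ c →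
  Injective _≡_ _≡_ c ×
  (∀ (i : Fin (suc (suc l))) → Adjacent S (c (inject₁ i)) (c (F.suc i))) ×
  Adjacent S (c (fromℕ (suc (suc l)))) (c F.zero)

Acyclic : ∀ {m} → EdgeSet m → Set
Acyclic S = ¬ HasCycle S

RestrictionIsoCompleteGraph : ∀ {n} → Matroid n → Subset n → ℕ → Set
RestrictionIsoCompleteGraph {n} M X m =
  Σ (Fin n → Fin m × Fin m) λ φ →
    (∀ x → x ∈ X → proj₁ (φ x) F.< proj₂ (φ x)) ×
    (∀ x y → x ∈ X → y ∈ X → φ x ≡ φ y → x ≡ y) ×
    (∀ i j → i F.< j → ∃ λ x → x ∈ X × φ x ≡ (i , j)) ×
    (∀ Y → Y ⊆ X →
      (Independent M Y → Acyclic (λ i j → ∃ λ x → x ∈ Y × φ x ≡ (i , j))) ×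
      (Acyclic (λ i j → ∃ λ x → x ∈ Y × φ x ≡ (i , j)) → Independent M Y))

#ParallelOutside : ∀ {n} → Matroid n → Subset n → Subset n → Fin n → ℕ
#ParallelOutside M C X b = ∣ ⟦ (λ x → ¬? (x ∈? X) ×-dec ParallelIn/? M C b x) ⟧ ∣

{-# OPTIONS --safe #-}
module Submission where

-- A frame B of M(K_{r+1}) is a spanning star, with centre c say.  If e ∉ cl(B′), there is a
-- spoke b = cj ∉ B′ such that e is an edge at j or an element outside X parallel to b in M/B′;
-- let S be the set of all such elements and G = B − b.  Then G spans every element outside S
-- but not e, so two distinct elements of E(N) − S never lie on a common line through e: the
-- lines through e and the elements of E(N) − S are distinct points of N/e.  As N is simple,
-- ε(N) = |E(N)| ≤ ε(N/e) + |E(N) ∩ S|, and |E(N) ∩ S| ≤ r(N) + k since the edges at j form an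
-- independent star and at most k elements outside X are parallel to b.

open import Defs
open import Data.Nat using (ℕ; zero; suc; _+_; _∸_; _≤_; _≟_; z≤n; s≤s)
import Data.Nat.Properties as ℕ
open import Data.Bool using (true; false)
open import Data.Fin as F using (Fin; inject₁; fromℕ; toℕ; lower₁)
import Data.Fin.Properties as F
open import Data.Fin.Subset using (Subset; _∈_; _∉_; _⊆_; _∪_; _∩_; _─_; _-_; ⁅_⁆; ⊥; ∣_∣)
open import Data.Fin.Subset.Properties
  using (_∈?_; p⊆p∪q; q⊆p∪q; x∈p∪q⁻; x∈⁅x⁆; x∈⁅y⁆⇒x≡y; ∉⊥; ∣⁅x⁆∣≡1; ∣⊥∣≡0; x≢y⇒x∉⁅y⁆;
         p⊂q⇒∣p∣<∣q∣; p⊆q⇒∣p∣≤∣q∣; ⊆-antisym; ∪-comm; ∪-assoc; ∪-identityʳ; nonempty?; Empty-unique;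
         x∈p∩q⁺; x∈p∩q⁻; p∩q⊆p; x∈p∧x≢y⇒x∈p-y; x∈p∧x∉q⇒x∈p─q; p─q⊆p; x∈p⇒∣p-x∣<∣p∣)
open import Data.Vec using ([]; _∷_; _[_]=_)
open _[_]=_ renaming (here to hereᵥ; there to thereᵥ)
import Data.Vec.Properties as Vec
open import Data.List using (List; []; _∷_; map; filter; length)
open import Data.List.Membership.Propositional using () renaming (_∈_ to _∈ₗ_)
open import Data.List.Membership.Propositional.Properties using (∈-map⁺; ∈-map⁻; ∈-filter⁺; ∈-filter⁻)
open import Data.List.Properties using (length-map)
open import Data.List.Relation.Binary.Subset.Propositional using () renaming (_⊆_ to _⊆ₗ_)
open import Data.List.Relation.Unary.All as All using (All; []; _∷_)
open import Data.List.Relation.Unary.AllPairs using ([]; _∷_)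
open import Data.List.Relation.Unary.Any using (here; there)
open import Data.List.Relation.Unary.Unique.Propositional using (Unique)
import Data.List.Relation.Unary.Unique.Propositional.Properties as Unique
open import Data.Empty using (⊥-elim)
open import Data.Product using (∃; ∃₂; _×_; _,_; proj₁; proj₂)
open import Data.Product.Properties using (,-injective)
open import Data.Sum using (_⊎_; inj₁; inj₂; [_,_]′)
open import Function using (Injective; _∘_)
open import Relation.Binary using (tri<; tri≈; tri>)
open import Relation.Nullary using (Dec; yes; no; ¬_)
open import Relation.Nullary.Decidable using (_×-dec_; _⊎-dec_; ¬?; decidable-stable)
open import Relation.Unary using (Decidable)
open import Relation.Binary.PropositionalEquality
  using (_≡_; _≢_; refl; sym; trans; cong; cong₂; subst; ≢-sym; module ≡-Reasoning)

private
  variable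
    n m : ℕ

module _ {A : Set} where

  private
    remove : ∀ {x : A} {ys} → x ∈ₗ ys →
      ∃ λ ys′ → length ys ≡ suc (length ys′) × (∀ {y} → y ∈ₗ ys → y ≢ x → y ∈ₗ ys′)
    remove {ys = _ ∷ ys} (here refl) =
      ys , refl , λ { (here refl) y≢x → ⊥-elim (y≢x refl) ; (there y∈) _ → y∈ }
    remove {ys = y ∷ _} (there x∈) with remove x∈
    ... | ys′ , eq , keep =
      y ∷ ys′ , cong suc eq , λ { (here refl) _ → here refl ; (there z∈) z≢x → there (keep z∈ z≢x) }

  unique-⊆⇒length≤ : ∀ {xs ys : List A} → Unique xs → xs ⊆ₗ ys → length xs ≤ length ys
  unique-⊆⇒length≤ {[]} _ _ = z≤n
  unique-⊆⇒length≤ {x ∷ xs} (x∉xs ∷ xs!) xs⊆ys with remove (xs⊆ys (here refl))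
  ... | ys′ , eq , keep = subst (suc (length xs) ≤_) (sym eq) (s≤s (unique-⊆⇒length≤ xs! xs⊆ys′))
    where
    xs⊆ys′ : xs ⊆ₗ ys′
    xs⊆ys′ y∈ = keep (xs⊆ys (there y∈)) λ { refl → All.lookup x∉xs y∈ refl }

module _ {A B : Set} (f : A → B) where

  map-unique : ∀ {xs} → Unique xs → (∀ {x y} → x ∈ₗ xs → y ∈ₗ xs → f x ≡ f y → x ≡ y) →
    Unique (map f xs)
  map-unique {[]} _ _ = []
  map-unique {x ∷ xs} (x∉xs ∷ xs!) inj =
    All.tabulate fx≢ ∷ map-unique xs! λ x∈ y∈ → inj (there x∈) (there y∈)
    where
    fx≢ : ∀ {z} → z ∈ₗ map f xs → f x ≢ z
    fx≢ z∈ fx≡z with ∈-map⁻ f z∈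
    ... | y , y∈ , refl = All.lookup x∉xs y∈ (inj (here refl) (there y∈) fx≡z)

∈⟦⟧⁺ : ∀ {P : Fin n → Set} (P? : Decidable P) {x} → P x → x ∈ ⟦ P? ⟧
∈⟦⟧⁺ P? {F.zero} px with P? F.zero
... | yes _  = hereᵥ
... | no ¬px = ⊥-elim (¬px px)
∈⟦⟧⁺ P? {F.suc x} px = thereᵥ (∈⟦⟧⁺ (λ y → P? (F.suc y)) px)

∈⟦⟧⁻ : ∀ {P : Fin n → Set} (P? : Decidable P) {x} → x ∈ ⟦ P? ⟧ → P x
∈⟦⟧⁻ P? {F.zero} x∈ with P? F.zero | x∈
... | yes px | _ = px
... | no _   | ()
∈⟦⟧⁻ P? {F.suc x} (thereᵥ x∈) = ∈⟦⟧⁻ (λ y → P? (F.suc y)) x∈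

∪-⊆ : ∀ {p q r : Subset n} → p ⊆ r → q ⊆ r → p ∪ q ⊆ r
∪-⊆ {p = p} {q} p⊆r q⊆r x∈ = [ p⊆r , q⊆r ]′ (x∈p∪q⁻ p q x∈)

x∈p─q⇒x∉q : ∀ {p q : Subset n} {x} → x ∈ p ─ q → x ∉ q
x∈p─q⇒x∉q {p = true ∷ p}  {false ∷ q} hereᵥ ()
x∈p─q⇒x∉q {p = _ ∷ p}     {_ ∷ q}     (thereᵥ x∈) (thereᵥ x∈q) = x∈p─q⇒x∉q x∈ x∈q

∣p∪q∣≤∣p∣+∣q∣ : (p q : Subset n) → ∣ p ∪ q ∣ ≤ ∣ p ∣ + ∣ q ∣
∣p∪q∣≤∣p∣+∣q∣ []          []          = z≤n
∣p∪q∣≤∣p∣+∣q∣ (true ∷ p)  (true ∷ q)  = s≤s (ℕ.≤-trans (∣p∪q∣≤∣p∣+∣q∣ p q) (ℕ.+-monoʳ-≤ ∣ p ∣ (ℕ.n≤1+n ∣ q ∣)))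
∣p∪q∣≤∣p∣+∣q∣ (true ∷ p)  (false ∷ q) = s≤s (∣p∪q∣≤∣p∣+∣q∣ p q)
∣p∪q∣≤∣p∣+∣q∣ (false ∷ p) (true ∷ q)  =
  ℕ.≤-trans (s≤s (∣p∪q∣≤∣p∣+∣q∣ p q)) (ℕ.≤-reflexive (sym (ℕ.+-suc ∣ p ∣ ∣ q ∣)))
∣p∪q∣≤∣p∣+∣q∣ (false ∷ p) (false ∷ q) = ∣p∪q∣≤∣p∣+∣q∣ p q

fromList : List (Fin n) → Subset n
fromList []       = ⊥
fromList (x ∷ xs) = ⁅ x ⁆ ∪ fromList xs

∈-fromList⁺ : ∀ {x : Fin n} {xs} → x ∈ₗ xs → x ∈ fromList xs
∈-fromList⁺ {xs = x ∷ xs}  (here refl) = p⊆p∪q (fromList xs) (x∈⁅x⁆ x)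
∈-fromList⁺ {xs = y ∷ xs} (there x∈)  = q⊆p∪q ⁅ y ⁆ (fromList xs) (∈-fromList⁺ x∈)

∈-fromList⁻ : ∀ {x : Fin n} {xs} → x ∈ fromList xs → x ∈ₗ xs
∈-fromList⁻ {xs = []}     x∈ = ⊥-elim (∉⊥ x∈)
∈-fromList⁻ {xs = y ∷ xs} x∈ with x∈p∪q⁻ ⁅ y ⁆ (fromList xs) x∈
... | inj₁ x∈y  = here (x∈⁅y⁆⇒x≡y y x∈y)
... | inj₂ x∈xs = there (∈-fromList⁻ x∈xs)

fromList-mono : ∀ {xs ys : List (Fin n)} → xs ⊆ₗ ys → fromList xs ⊆ fromList ys
fromList-mono xs⊆ys x∈ = ∈-fromList⁺ (xs⊆ys (∈-fromList⁻ x∈))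

x∉p⇒∣p∪⁅x⁆∣≡1+∣p∣ : ∀ {p : Subset n} {x} → x ∉ p → ∣ p ∪ ⁅ x ⁆ ∣ ≡ suc ∣ p ∣
x∉p⇒∣p∪⁅x⁆∣≡1+∣p∣ {p = p} {x} x∉p = ℕ.≤-antisym
  (ℕ.≤-trans (∣p∪q∣≤∣p∣+∣q∣ p ⁅ x ⁆) (ℕ.≤-reflexive (trans (cong (∣ p ∣ +_) (∣⁅x⁆∣≡1 x)) (ℕ.+-comm ∣ p ∣ 1))))
  (p⊂q⇒∣p∣<∣q∣ (p⊆p∪q ⁅ x ⁆ , x , q⊆p∪q p ⁅ x ⁆ (x∈⁅x⁆ x) , x∉p))

x∈p⇒⁅x⁆⊆p : ∀ {p : Subset n} {x} → x ∈ p → ⁅ x ⁆ ⊆ p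
x∈p⇒⁅x⁆⊆p {p = p} {x} x∈p y∈ = subst (_∈ p) (sym (x∈⁅y⁆⇒x≡y x y∈)) x∈p

fromList⊆ : ∀ {p : Subset n} {xs} → All (_∈ p) xs → fromList xs ⊆ p
fromList⊆ xs⊆p x∈ = All.lookup xs⊆p (∈-fromList⁻ x∈)

elements : Subset n → List (Fin n)
elements []          = []
elements (true ∷ p)  = F.zero ∷ map F.suc (elements p)
elements (false ∷ p) = map F.suc (elements p)

length-elements : (p : Subset n) → length (elements p) ≡ ∣ p ∣
length-elements []          = refl
length-elements (true ∷ p)  = cong suc (trans (length-map F.suc (elements p)) (length-elements p))
length-elements (false ∷ p) = trans (length-map F.suc (elements p)) (length-elements p)

∈-elements⁺ : ∀ {p : Subset n} {x} → x ∈ p → x ∈ₗ elements p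
∈-elements⁺ {p = true ∷ p}  hereᵥ       = here refl
∈-elements⁺ {p = true ∷ p}  (thereᵥ x∈) = there (∈-map⁺ F.suc (∈-elements⁺ x∈))
∈-elements⁺ {p = false ∷ p} (thereᵥ x∈) = ∈-map⁺ F.suc (∈-elements⁺ x∈)

∈-elements⁻ : ∀ {p : Subset n} {x} → x ∈ₗ elements p → x ∈ p
∈-elements⁻ {p = true ∷ p} (here refl) = hereᵥ
∈-elements⁻ {p = true ∷ p} (there x∈) with ∈-map⁻ F.suc x∈
... | _ , y∈ , refl = thereᵥ (∈-elements⁻ y∈)
∈-elements⁻ {p = false ∷ p} x∈ with ∈-map⁻ F.suc x∈
... | _ , y∈ , refl = thereᵥ (∈-elements⁻ y∈)

elements-unique : (p : Subset n) → Unique (elements p)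
elements-unique []          = []
elements-unique (true ∷ p)  =
  All.tabulate zero∉ ∷ Unique.map⁺ F.suc-injective (elements-unique p)
  where
  zero∉ : ∀ {x} → x ∈ₗ map F.suc (elements p) → F.zero ≢ x
  zero∉ x∈ 0≡x with ∈-map⁻ F.suc x∈
  zero∉ x∈ () | _ , _ , refl
elements-unique (false ∷ p) = Unique.map⁺ F.suc-injective (elements-unique p)

allSubsets-unique : ∀ n → Unique (allSubsets n)
allSubsets-unique zero    = All.[] ∷ []
allSubsets-unique (suc n) =
  Unique.++⁺ (Unique.map⁺ Vec.∷-injectiveʳ (allSubsets-unique n))
             (Unique.map⁺ Vec.∷-injectiveʳ (allSubsets-unique n))
             λ (p∈ , q∈) → headsDiffer p∈ q∈
  where
  headsDiffer : ∀ {v} → v ∈ₗ map (true ∷_) (allSubsets n) → ¬ v ∈ₗ map (false ∷_) (allSubsets n)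
  headsDiffer p∈ q∈ with ∈-map⁻ (true ∷_) p∈ | ∈-map⁻ (false ∷_) q∈
  ... | _ , _ , refl | _ , _ , ()

module _ {Q : Subset n → Set} (Q? : Decidable Q) where

  ∣p∣≤#Subsets : (p : Subset n) (f : Fin n → Subset n) → (∀ {z} → z ∈ p → Q (f z)) →
    (∀ {z z′} → z ∈ p → z′ ∈ p → f z ≡ f z′ → z ≡ z′) → ∣ p ∣ ≤ #Subsets Q?
  ∣p∣≤#Subsets p f Qf inj =
    subst (_≤ #Subsets Q?) (trans (length-map f (elements p)) (length-elements p))
      (unique-⊆⇒length≤ (map-unique f (elements-unique p) λ z∈ z′∈ → inj (∈-elements⁻ z∈) (∈-elements⁻ z′∈))
                         image⊆)
    where
    image⊆ : map f (elements p) ⊆ₗ filter Q? (allSubsets n)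
    image⊆ y∈ with ∈-map⁻ f y∈
    ... | z , z∈ , refl = ∈-filter⁺ Q? (allSubsets-complete (f z)) (Qf (∈-elements⁻ z∈))

  #Subsets≤∣p∣ : (p : Subset n) → (∀ s → Q s → ∃ λ z → z ∈ p × s ≡ ⁅ z ⁆) → #Subsets Q? ≤ ∣ p ∣
  #Subsets≤∣p∣ p singleton =
    subst (#Subsets Q? ≤_) (trans (length-map ⁅_⁆ (elements p)) (length-elements p))
      (unique-⊆⇒length≤ (Unique.filter⁺ Q? (allSubsets-unique n)) filter⊆)
    where
    filter⊆ : filter Q? (allSubsets n) ⊆ₗ map ⁅_⁆ (elements p)
    filter⊆ {s} s∈ with singleton s (proj₂ (∈-filter⁻ Q? {xs = allSubsets n} s∈))
    ... | z , z∈ , refl = ∈-map⁺ ⁅_⁆ (∈-elements⁺ z∈)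

-- Rank, closure and contraction

module _ (M : Matroid n) where
  open Matroid M

  Spans : Subset n → Fin n → Set
  Spans A y = r (A ∪ ⁅ y ⁆) ≡ r A

  spans? : ∀ A y → Dec (Spans A y)
  spans? A y = r (A ∪ ⁅ y ⁆) ≟ r A

  r-⊥ : r ⊥ ≡ 0
  r-⊥ = ℕ.n≤0⇒n≡0 (ℕ.≤-trans (r-bound ⊥) (ℕ.≤-reflexive (∣⊥∣≡0 n)))

  ≤⇒spans : ∀ {A y} → r (A ∪ ⁅ y ⁆) ≤ r A → Spans A y
  ≤⇒spans {A} {y} ≤rA = ℕ.≤-antisym ≤rA (r-mono (p⊆p∪q ⁅ y ⁆))

  ∈⇒spans : ∀ {A y} → y ∈ A → Spans A y
  ∈⇒spans {A} {y} y∈A =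
    cong r (⊆-antisym (∪-⊆ (λ x∈ → x∈) (x∈p⇒⁅x⁆⊆p y∈A)) (p⊆p∪q ⁅ y ⁆))

  fromList-spans : ∀ xs {x} → x ∈ₗ xs → Spans (fromList xs) x
  fromList-spans _ x∈ = ∈⇒spans (∈-fromList⁺ x∈)

  spans-mono : ∀ {A A′ y} → A ⊆ A′ → Spans A y → Spans A′ y
  spans-mono {A} {A′} {y} A⊆A′ A↝y = ≤⇒spans (ℕ.+-cancelʳ-≤ (r A) _ _ bound)
    where
    open ℕ.≤-Reasoning
    bound : r (A′ ∪ ⁅ y ⁆) + r A ≤ r A′ + r A
    bound = begin
      r (A′ ∪ ⁅ y ⁆) + r A
        ≤⟨ ℕ.+-mono-≤ (r-mono (∪-⊆ (p⊆p∪q _) (λ x∈ → q⊆p∪q A′ _ (q⊆p∪q A _ x∈))))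
                      (r-mono (λ x∈ → x∈p∩q⁺ (A⊆A′ x∈ , p⊆p∪q ⁅ y ⁆ x∈))) ⟩
      r (A′ ∪ (A ∪ ⁅ y ⁆)) + r (A′ ∩ (A ∪ ⁅ y ⁆)) ≤⟨ r-submod A′ (A ∪ ⁅ y ⁆) ⟩
      r A′ + r (A ∪ ⁅ y ⁆)                       ≡⟨ cong (r A′ +_) A↝y ⟩
      r A′ + r A                                 ∎

  r-∪-spanned : ∀ {A W} → (∀ {w} → w ∈ W → Spans A w) → r (A ∪ W) ≡ r A
  r-∪-spanned {A} {W} A↝W = ℕ.≤-antisym (begin
    r (A ∪ W)                     ≤⟨ r-mono (∪-⊆ (p⊆p∪q _) (λ w∈ → q⊆p∪q A _ (∈-fromList⁺ (∈-elements⁺ w∈)))) ⟩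
    r (A ∪ fromList (elements W)) ≡⟨ r-∪-fromList (elements W) (All.tabulate (A↝W ∘ ∈-elements⁻)) ⟩
    r A                           ∎)
    (r-mono (p⊆p∪q W))
    where
    open ℕ.≤-Reasoning
    r-∪-fromList : ∀ xs → All (Spans A) xs → r (A ∪ fromList xs) ≡ r A
    r-∪-fromList []       []           = cong r (∪-identityʳ A)
    r-∪-fromList (x ∷ xs) (A↝x ∷ A↝xs) = begin-equality
      r (A ∪ (⁅ x ⁆ ∪ fromList xs)) ≡⟨ cong (λ T → r (A ∪ T)) (∪-comm ⁅ x ⁆ (fromList xs)) ⟩
      r (A ∪ (fromList xs ∪ ⁅ x ⁆)) ≡⟨ cong r (sym (∪-assoc A (fromList xs) ⁅ x ⁆)) ⟩
      r ((A ∪ fromList xs) ∪ ⁅ x ⁆) ≡⟨ spans-mono (p⊆p∪q (fromList xs)) A↝x ⟩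
      r (A ∪ fromList xs)           ≡⟨ r-∪-fromList xs A↝xs ⟩
      r A                           ∎

  spans-trans : ∀ {A W x} → (∀ {w} → w ∈ W → Spans A w) → Spans W x → Spans A x
  spans-trans {A} {W} {x} A↝W W↝x = ≤⇒spans (begin
    r (A ∪ ⁅ x ⁆)       ≤⟨ r-mono (∪-⊆ (λ y∈ → p⊆p∪q _ (p⊆p∪q W y∈)) (q⊆p∪q _ ⁅ x ⁆)) ⟩
    r ((A ∪ W) ∪ ⁅ x ⁆) ≡⟨ spans-mono (q⊆p∪q A W) W↝x ⟩
    r (A ∪ W)           ≡⟨ r-∪-spanned A↝W ⟩
    r A                 ∎)
    where open ℕ.≤-Reasoning

  independent⇒unspanned : ∀ {I x} → Independent M I → x ∈ I → ¬ Spans (I - x) x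
  independent⇒unspanned {I} {x} I-indep x∈I I-x↝x = ℕ.<-irrefl refl (begin-strict
    r I                    ≤⟨ r-mono I⊆ ⟩
    r ((I - x) ∪ ⁅ x ⁆)    ≡⟨ I-x↝x ⟩
    r (I - x)              ≤⟨ r-bound (I - x) ⟩
    ∣ I - x ∣              <⟨ x∈p⇒∣p-x∣<∣p∣ x∈I ⟩
    ∣ I ∣                  ≡⟨ sym I-indep ⟩
    r I                    ∎)
    where
    open ℕ.≤-Reasoning
    I⊆ : I ⊆ (I - x) ∪ ⁅ x ⁆
    I⊆ {y} y∈I with y F.≟ x
    ... | yes refl = q⊆p∪q _ ⁅ x ⁆ (x∈⁅x⁆ x)
    ... | no y≢x   = p⊆p∪q ⁅ x ⁆ (x∈p∧x≢y⇒x∈p-y y∈I y≢x)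

  rc≡1⇒r≡suc : ∀ {C Y} → rc M C Y ≡ 1 → r (Y ∪ C) ≡ suc (r C)
  rc≡1⇒r≡suc {C} {Y} rc≡1 = begin
    r (Y ∪ C)             ≡⟨ sym (ℕ.m∸n+n≡m (r-mono (q⊆p∪q Y C))) ⟩
    r (Y ∪ C) ∸ r C + r C ≡⟨ cong (_+ r C) rc≡1 ⟩
    suc (r C)             ∎
    where open ≡-Reasoning

  loop⇒spans : ∀ {C y} → LoopIn/ M C y → Spans C y
  loop⇒spans {C} {y} loop = ≤⇒spans (subst (_≤ r C) (cong r (∪-comm ⁅ y ⁆ C)) (ℕ.m∸n≡0⇒m≤n loop))

  parallel-sym : ∀ {C y d} → ParallelIn/ M C y d → ParallelIn/ M C d y
  parallel-sym {C} {y} {d} (y≢d , y≠loop , d≠loop , yd-rank) =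
    ≢-sym y≢d , d≠loop , y≠loop , trans (cong (rc M C) (∪-comm ⁅ d ⁆ ⁅ y ⁆)) yd-rank

  parallel⇒spans : ∀ {C y d} → ParallelIn/ M C y d → Spans (C ∪ ⁅ d ⁆) y
  parallel⇒spans {C} {y} {d} (_ , _ , d≠loop , yd-rank) = begin
    r ((C ∪ ⁅ d ⁆) ∪ ⁅ y ⁆) ≡⟨ cong r (∪-comm (C ∪ ⁅ d ⁆) ⁅ y ⁆) ⟩
    r (⁅ y ⁆ ∪ (C ∪ ⁅ d ⁆)) ≡⟨ cong (λ S → r (⁅ y ⁆ ∪ S)) (∪-comm C ⁅ d ⁆) ⟩
    r (⁅ y ⁆ ∪ (⁅ d ⁆ ∪ C)) ≡⟨ cong r (sym (∪-assoc ⁅ y ⁆ ⁅ d ⁆ C)) ⟩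
    r ((⁅ y ⁆ ∪ ⁅ d ⁆) ∪ C) ≡⟨ rc≡1⇒r≡suc yd-rank ⟩
    suc (r C)               ≡⟨ sym (rc≡1⇒r≡suc d≠loop) ⟩
    r (⁅ d ⁆ ∪ C)           ≡⟨ cong r (∪-comm ⁅ d ⁆ C) ⟩
    r (C ∪ ⁅ d ⁆)           ∎
    where open ≡-Reasoning

-- Simple matroids

module _ (M : Matroid n) (simple : Simple M) where
  open Matroid M

  r-pair : ∀ {x y} → x ≢ y → r (⁅ x ⁆ ∪ ⁅ y ⁆) ≡ 2
  r-pair = proj₂ simple _ _

  point⇒singleton : ∀ {Z P} → IsPointOf M r Z P → ∃ λ z → z ∈ Z × P ≡ ⁅ z ⁆
  point⇒singleton {Z} {P} (P⊆Z , rP≡1 , _) with nonempty? P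
  ... | no P-empty = ⊥-elim (0≢1 (trans (sym (r-⊥ M)) (trans (cong r (sym (Empty-unique P-empty))) rP≡1)))
    where
    0≢1 : 0 ≢ 1
    0≢1 ()
  ... | yes (z , z∈P) = z , P⊆Z z∈P , ⊆-antisym P⊆z (x∈p⇒⁅x⁆⊆p z∈P)
    where
    P⊆z : P ⊆ ⁅ z ⁆
    P⊆z {y} y∈P with y F.≟ z
    ... | yes refl = x∈⁅x⁆ y
    ... | no y≢z   = ⊥-elim (2≰1 (begin
      2                 ≡⟨ sym (r-pair (≢-sym y≢z)) ⟩
      r (⁅ z ⁆ ∪ ⁅ y ⁆) ≤⟨ r-mono (∪-⊆ (x∈p⇒⁅x⁆⊆p z∈P) (x∈p⇒⁅x⁆⊆p y∈P)) ⟩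
      r P               ≡⟨ rP≡1 ⟩
      1                 ∎))
      where
      open ℕ.≤-Reasoning
      2≰1 : ¬ 2 ≤ 1
      2≰1 (s≤s ())

  spanned-by-two : ∀ {S x} → ∣ S ∣ ≤ 2 → Spans M S x →
    x ∈ S ⊎ ∃₂ λ a a′ → a ∈ S × a′ ∈ S × a ≢ a′ × a ≢ x × a′ ≢ x × r ((⁅ a ⁆ ∪ ⁅ a′ ⁆) ∪ ⁅ x ⁆) ≤ 2
  spanned-by-two {S} {x} ∣S∣≤2 S↝x =
    by-elements (elements S) (elements-unique S) ∈-elements⁻
      (subst (r S ≤_) (sym (length-elements S)) (r-bound S))
      (subst (_≤ 2) (sym (length-elements S)) ∣S∣≤2)
    where
    open ℕ.≤-Reasoning
    by-elements : ∀ xs → Unique xs → (∀ {y} → y ∈ₗ xs → y ∈ S) → r S ≤ length xs → length xs ≤ 2 →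
      x ∈ S ⊎ ∃₂ λ a a′ → a ∈ S × a′ ∈ S × a ≢ a′ × a ≢ x × a′ ≢ x × r ((⁅ a ⁆ ∪ ⁅ a′ ⁆) ∪ ⁅ x ⁆) ≤ 2
    by-elements [] _ _ rS≤0 _ = ⊥-elim (ℕ.<-irrefl refl (begin-strict
      0                 <⟨ s≤s z≤n ⟩
      1                 ≡⟨ sym (proj₁ simple x) ⟩
      r ⁅ x ⁆           ≤⟨ r-mono (q⊆p∪q S ⁅ x ⁆) ⟩
      r (S ∪ ⁅ x ⁆)     ≡⟨ S↝x ⟩
      r S               ≤⟨ rS≤0 ⟩
      0                 ∎))
    by-elements (a ∷ []) _ ⊆S rS≤1 _ with x F.≟ a
    ... | yes refl = inj₁ (⊆S (here refl))
    ... | no x≢a   = ⊥-elim (ℕ.<-irrefl refl (begin-strict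
      1                 <⟨ s≤s (s≤s z≤n) ⟩
      2                 ≡⟨ sym (r-pair (≢-sym x≢a)) ⟩
      r (⁅ a ⁆ ∪ ⁅ x ⁆) ≤⟨ r-mono (∪-⊆ (p⊆p∪q ⁅ x ⁆ ∘ x∈p⇒⁅x⁆⊆p (⊆S (here refl))) (q⊆p∪q S ⁅ x ⁆)) ⟩
      r (S ∪ ⁅ x ⁆)     ≡⟨ S↝x ⟩
      r S               ≤⟨ rS≤1 ⟩
      1                 ∎))
    by-elements (a ∷ a′ ∷ []) ((a≢a′ ∷ []) ∷ _) ⊆S rS≤2 _ with x F.≟ a | x F.≟ a′
    ... | yes refl | _        = inj₁ (⊆S (here refl))
    ... | no _     | yes refl = inj₁ (⊆S (there (here refl)))
    ... | no x≢a   | no x≢a′  = inj₂ (a , a′ , a∈S , a′∈S , a≢a′ , ≢-sym x≢a , ≢-sym x≢a′ , (begin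
      r ((⁅ a ⁆ ∪ ⁅ a′ ⁆) ∪ ⁅ x ⁆) ≤⟨ r-mono (∪-⊆ (p⊆p∪q ⁅ x ⁆ ∘ ∪-⊆ (x∈p⇒⁅x⁆⊆p a∈S) (x∈p⇒⁅x⁆⊆p a′∈S))
                                                   (q⊆p∪q S ⁅ x ⁆)) ⟩
      r (S ∪ ⁅ x ⁆)               ≡⟨ S↝x ⟩
      r S                         ≤⟨ rS≤2 ⟩
      2                           ∎))
      where
      a∈S = ⊆S (here refl)
      a′∈S = ⊆S (there (here refl))
    by-elements (_ ∷ _ ∷ _ ∷ _) _ _ _ (s≤s (s≤s ()))

  ε≤∣Z∣ : ∀ Z → ε M r Z ≤ ∣ Z ∣
  ε≤∣Z∣ Z = #Subsets≤∣p∣ (IsPointOf? M r Z) Z λ _ → point⇒singleton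

  exchange : ∀ {e z z′} → e ≢ z → z ≢ z′ → Spans M (⁅ e ⁆ ∪ ⁅ z ⁆) z′ → Spans M (⁅ z ⁆ ∪ ⁅ z′ ⁆) e
  exchange {e} {z} {z′} e≢z z≢z′ ez↝z′ = ≤⇒spans M (begin
    r ((⁅ z ⁆ ∪ ⁅ z′ ⁆) ∪ ⁅ e ⁆) ≤⟨ r-mono (∪-⊆ (∪-⊆ (λ x∈ → p⊆p∪q _ (q⊆p∪q ⁅ e ⁆ _ x∈)) (q⊆p∪q _ _))
                                               (λ x∈ → p⊆p∪q _ (p⊆p∪q ⁅ z ⁆ x∈))) ⟩
    r ((⁅ e ⁆ ∪ ⁅ z ⁆) ∪ ⁅ z′ ⁆) ≡⟨ ez↝z′ ⟩
    r (⁅ e ⁆ ∪ ⁅ z ⁆)            ≡⟨ r-pair e≢z ⟩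
    2                            ≡⟨ sym (r-pair z≢z′) ⟩
    r (⁅ z ⁆ ∪ ⁅ z′ ⁆)           ∎)
    where open ℕ.≤-Reasoning

  module _ {e : Fin n} {S G : Subset n} (e∈S : e ∈ S) (G↛e : ¬ Spans M G e)
           (G↝∁S : ∀ {y} → y ∉ S → Spans M G y) where

    module _ (Z : Subset n) where

      line : Fin n → Subset n
      line z = ⟦ (λ y → y ∈? (Z - e) ×-dec spans? M (⁅ e ⁆ ∪ ⁅ z ⁆) y) ⟧

      line⁺ : ∀ {z y} → y ∈ Z - e → Spans M (⁅ e ⁆ ∪ ⁅ z ⁆) y → y ∈ line z
      line⁺ {z} y∈ ez↝y = ∈⟦⟧⁺ (λ y → y ∈? (Z - e) ×-dec spans? M (⁅ e ⁆ ∪ ⁅ z ⁆) y) (y∈ , ez↝y)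

      line⁻ : ∀ {z y} → y ∈ line z → y ∈ Z - e × Spans M (⁅ e ⁆ ∪ ⁅ z ⁆) y
      line⁻ {z} = ∈⟦⟧⁻ (λ y → y ∈? (Z - e) ×-dec spans? M (⁅ e ⁆ ∪ ⁅ z ⁆) y)

      module _ {z : Fin n} (z∈ : z ∈ Z ─ S) where

        z≢e : z ≢ e
        z≢e refl = x∈p─q⇒x∉q z∈ e∈S

        e≢z : e ≢ z
        e≢z = ≢-sym z≢e

        z∈line : z ∈ line z
        z∈line = line⁺ (x∈p∧x≢y⇒x∈p-y (p─q⊆p Z S z∈) z≢e) (∈⇒spans M (q⊆p∪q ⁅ e ⁆ ⁅ z ⁆ (x∈⁅x⁆ z)))

        ez⊆ : ∀ {Q} → line z ⊆ Q → ⁅ e ⁆ ∪ ⁅ z ⁆ ⊆ Q ∪ ⁅ e ⁆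
        ez⊆ {Q} line⊆Q = ∪-⊆ (q⊆p∪q Q ⁅ e ⁆) (p⊆p∪q ⁅ e ⁆ ∘ x∈p⇒⁅x⁆⊆p (line⊆Q z∈line))

        r-line : r (line z ∪ ⁅ e ⁆) ≡ 2
        r-line = ℕ.≤-antisym (begin
          r (line z ∪ ⁅ e ⁆)                       ≤⟨ r-mono (q⊆p∪q (⁅ e ⁆ ∪ ⁅ z ⁆) _) ⟩
          r ((⁅ e ⁆ ∪ ⁅ z ⁆) ∪ (line z ∪ ⁅ e ⁆)) ≡⟨ r-∪-spanned M spanned ⟩
          r (⁅ e ⁆ ∪ ⁅ z ⁆)                        ≡⟨ r-pair e≢z ⟩
          2                                        ∎)
          (begin
          2                   ≡⟨ sym (r-pair e≢z) ⟩
          r (⁅ e ⁆ ∪ ⁅ z ⁆)   ≤⟨ r-mono (ez⊆ (λ x∈ → x∈)) ⟩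
          r (line z ∪ ⁅ e ⁆)  ∎)
          where
          open ℕ.≤-Reasoning
          spanned : ∀ {y} → y ∈ line z ∪ ⁅ e ⁆ → Spans M (⁅ e ⁆ ∪ ⁅ z ⁆) y
          spanned {y} y∈ with x∈p∪q⁻ (line z) ⁅ e ⁆ y∈
          ... | inj₁ y∈line = proj₂ (line⁻ y∈line)
          ... | inj₂ y∈e    = ∈⇒spans M (p⊆p∪q ⁅ z ⁆ y∈e)

        line-isPoint : IsPointOf M (rc M ⁅ e ⁆) (Z - e) (line z)
        line-isPoint = (λ y∈ → proj₁ (line⁻ y∈)) , cong₂ _∸_ r-line (proj₁ simple e) , maximal
          where
          maximal : ∀ Q → Q ⊆ Z - e → line z ⊆ Q → rc M ⁅ e ⁆ Q ≡ 1 → Q ⊆ line z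
          maximal Q Q⊆ line⊆Q rcQ≡1 y∈Q = line⁺ (Q⊆ y∈Q) (≤⇒spans M (begin
            r ((⁅ e ⁆ ∪ ⁅ z ⁆) ∪ ⁅ _ ⁆) ≤⟨ r-mono (∪-⊆ (ez⊆ line⊆Q) (p⊆p∪q ⁅ e ⁆ ∘ x∈p⇒⁅x⁆⊆p y∈Q)) ⟩
            r (Q ∪ ⁅ e ⁆)               ≡⟨ rc≡1⇒r≡suc M rcQ≡1 ⟩
            suc (r ⁅ e ⁆)               ≡⟨ cong suc (proj₁ simple e) ⟩
            2                           ≡⟨ sym (r-pair e≢z) ⟩
            r (⁅ e ⁆ ∪ ⁅ z ⁆)           ∎))
            where open ℕ.≤-Reasoning

      -- Two elements outside S on a common line through e would put e in the closure of G.
      line-injective : ∀ {z z′} → z ∈ Z ─ S → z′ ∈ Z ─ S → line z ≡ line z′ → z ≡ z′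
      line-injective {z} {z′} z∈ z′∈ eq with z F.≟ z′
      ... | yes z≡z′ = z≡z′
      ... | no z≢z′  = ⊥-elim (G↛e (spans-trans M G↝zz′ (exchange (e≢z z∈) z≢z′ ez↝z′)))
        where
        ez↝z′ : Spans M (⁅ e ⁆ ∪ ⁅ z ⁆) z′
        ez↝z′ = proj₂ (line⁻ (subst (z′ ∈_) (sym eq) (z∈line z′∈)))
        G↝zz′ : ∀ {y} → y ∈ ⁅ z ⁆ ∪ ⁅ z′ ⁆ → Spans M G y
        G↝zz′ y∈ with x∈p∪q⁻ ⁅ z ⁆ ⁅ z′ ⁆ y∈
        ... | inj₁ y∈z  = subst (Spans M G) (sym (x∈⁅y⁆⇒x≡y z y∈z)) (G↝∁S (x∈p─q⇒x∉q z∈))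
        ... | inj₂ y∈z′ = subst (Spans M G) (sym (x∈⁅y⁆⇒x≡y z′ y∈z′)) (G↝∁S (x∈p─q⇒x∉q z′∈))

    ε≤ε/e+∣Z∩S∣ : ∀ Z → ε M r Z ≤ ε M (rc M ⁅ e ⁆) (Z - e) + ∣ Z ∩ S ∣
    ε≤ε/e+∣Z∩S∣ Z = begin
      ε M r Z                                       ≤⟨ ε≤∣Z∣ Z ⟩
      ∣ Z ∣                                          ≤⟨ p⊆q⇒∣p∣≤∣q∣ Z⊆ ⟩
      ∣ (Z ─ S) ∪ (Z ∩ S) ∣                          ≤⟨ ∣p∪q∣≤∣p∣+∣q∣ (Z ─ S) (Z ∩ S) ⟩
      ∣ Z ─ S ∣ + ∣ Z ∩ S ∣                          ≤⟨ ℕ.+-monoˡ-≤ ∣ Z ∩ S ∣ ∣Z─S∣≤ε ⟩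
      ε M (rc M ⁅ e ⁆) (Z - e) + ∣ Z ∩ S ∣           ∎
      where
      open ℕ.≤-Reasoning
      Z⊆ : Z ⊆ (Z ─ S) ∪ (Z ∩ S)
      Z⊆ {y} y∈Z with y ∈? S
      ... | yes y∈S = q⊆p∪q (Z ─ S) _ (x∈p∩q⁺ (y∈Z , y∈S))
      ... | no y∉S  = p⊆p∪q (Z ∩ S) (x∈p∧x∉q⇒x∈p─q y∈Z y∉S)
      ∣Z─S∣≤ε : ∣ Z ─ S ∣ ≤ ε M (rc M ⁅ e ⁆) (Z - e)
      ∣Z─S∣≤ε = ∣p∣≤#Subsets (IsPointOf? M (rc M ⁅ e ⁆) (Z - e)) (Z ─ S) (line Z)
                  (line-isPoint Z) (line-injective Z)

-- The cycle matroid of a complete graph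

Pendant : EdgeSet m → Fin m → Set
Pendant S v = ∃ λ u → ∀ w → Adjacent S v w → w ≡ u

module _ (S : EdgeSet m) where

  adjacent-sym : ∀ {u v} → Adjacent S u v → Adjacent S v u
  adjacent-sym = [ inj₂ , inj₁ ]′

  module Cycle {l : ℕ} {c : Fin (suc (suc (suc l))) → Fin m} (c-inj : Injective _≡_ _≡_ c)
    (adj : ∀ (i : Fin (suc (suc l))) → Adjacent S (c (inject₁ i)) (c (F.suc i)))
    (close : Adjacent S (c (fromℕ (suc (suc l)))) (c F.zero)) where

    neighbours : ∀ t → ∃₂ λ a b → a ≢ b × Adjacent S (c t) (c a) × Adjacent S (c t) (c b)
    neighbours F.zero = F.suc F.zero , fromℕ (suc (suc l)) , (λ ()) , adj F.zero , adjacent-sym close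
    neighbours (F.suc i) with i F.≟ fromℕ (suc l)
    ... | yes refl = inject₁ i , F.zero , (λ ()) , adjacent-sym (adj i) , close
    ... | no i≢last =
      inject₁ i , F.suc i′ , pred≢succ , adjacent-sym (adj i) ,
      subst (λ k → Adjacent S (c k) (c (F.suc i′))) inject₁i′≡suci (adj i′)
      where
      not-last : suc (suc l) ≢ toℕ (F.suc i)
      not-last eq = i≢last (F.toℕ-injective (trans (ℕ.suc-injective (sym eq)) (sym (F.toℕ-fromℕ (suc l)))))
      i′ = lower₁ (F.suc i) not-last
      inject₁i′≡suci : inject₁ i′ ≡ F.suc i
      inject₁i′≡suci = F.inject₁-lower₁ (F.suc i) not-last
      pred≢succ : inject₁ i ≢ F.suc i′
      pred≢succ eq = ℕ.<-irrefl toℕi≡2+toℕi (s≤s (ℕ.n≤1+n (toℕ i)))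
        where
        toℕi≡2+toℕi : toℕ i ≡ suc (suc (toℕ i))
        toℕi≡2+toℕi = trans (sym (F.toℕ-inject₁ i))
          (trans (cong toℕ eq) (cong suc (trans (sym (F.toℕ-inject₁ i′)) (cong toℕ inject₁i′≡suci))))

    pendant-off-cycle : ∀ t → ¬ Pendant S (c t)
    pendant-off-cycle t (u , only-u) with neighbours t
    ... | a , b , a≢b , t∼a , t∼b = a≢b (c-inj (trans (only-u _ t∼a) (sym (only-u _ t∼b))))

module CycleMatroid (M : Matroid n) (X : Subset n) (iso : RestrictionIsoCompleteGraph M X m) where
  open Matroid M

  φ : Fin n → Fin m × Fin m
  φ = proj₁ iso

  Edges : Subset n → EdgeSet m
  Edges Y i j = ∃ λ x → x ∈ Y × φ x ≡ (i , j)

  φ-ordered : ∀ {x} → x ∈ X → proj₁ (φ x) F.< proj₂ (φ x)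
  φ-ordered = proj₁ (proj₂ iso) _

  φ≡⇒< : ∀ {x u v} → x ∈ X → φ x ≡ (u , v) → u F.< v
  φ≡⇒< x∈ φx = subst (λ (u , v) → u F.< v) φx (φ-ordered x∈)

  φ-injective : ∀ {x y} → x ∈ X → y ∈ X → φ x ≡ φ y → x ≡ y
  φ-injective = proj₁ (proj₂ (proj₂ iso)) _ _

  φ-surjective : ∀ {i j} → i F.< j → ∃ λ x → x ∈ X × φ x ≡ (i , j)
  φ-surjective = proj₁ (proj₂ (proj₂ (proj₂ iso))) _ _

  independent⇒acyclic : ∀ {Y} → Y ⊆ X → Independent M Y → Acyclic (Edges Y)
  independent⇒acyclic Y⊆X = proj₁ (proj₂ (proj₂ (proj₂ (proj₂ iso))) _ Y⊆X)

  acyclic⇒independent : ∀ {Y} → Y ⊆ X → Acyclic (Edges Y) → Independent M Y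
  acyclic⇒independent Y⊆X = proj₂ (proj₂ (proj₂ (proj₂ (proj₂ iso))) _ Y⊆X)

  infix 4 _touches_
  _touches_ : Fin n → Fin m → Set
  x touches v = proj₁ (φ x) ≡ v ⊎ proj₂ (φ x) ≡ v

  Joins : Fin n → Fin m → Fin m → Set
  Joins x u v = x touches u × x touches v

  Between : Fin n → Fin m → Fin m → Set
  Between x u v = φ x ≡ (u , v) ⊎ φ x ≡ (v , u)

  between⇒joins : ∀ {y a b} → Between y a b → Joins y a b
  between⇒joins (inj₁ φy) = inj₁ (cong proj₁ φy) , inj₂ (cong proj₂ φy)
  between⇒joins (inj₂ φy) = inj₂ (cong proj₂ φy) , inj₁ (cong proj₁ φy)

  between⇒touches : ∀ {y a b j} → Between y a b → y touches j → a ≡ j ⊎ b ≡ j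
  between⇒touches (inj₁ refl) y∼j = y∼j
  between⇒touches (inj₂ refl) y∼j = [ inj₂ , inj₁ ]′ y∼j

  touches⇒between : ∀ {y j} → y touches j → ∃ λ u → Between y j u
  touches⇒between (inj₁ refl) = _ , inj₁ refl
  touches⇒between (inj₂ refl) = _ , inj₂ refl

  between-functional : ∀ {y a b b′} → Between y a b → Between y a b′ → b ≡ b′
  between-functional (inj₁ φ₁) (inj₁ φ₂) = proj₂ (,-injective (trans (sym φ₁) φ₂))
  between-functional (inj₁ φ₁) (inj₂ φ₂) = let a≡b′ , b≡a = ,-injective (trans (sym φ₁) φ₂) in trans b≡a a≡b′
  between-functional (inj₂ φ₁) (inj₁ φ₂) = let b≡a , a≡b′ = ,-injective (trans (sym φ₁) φ₂) in trans b≡a a≡b′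
  between-functional (inj₂ φ₁) (inj₂ φ₂) = proj₁ (,-injective (trans (sym φ₁) φ₂))

  joins⇒between : ∀ {x u v} → Joins x u v → u ≢ v → Between x u v
  joins⇒between (inj₁ refl , inj₁ refl) u≢v = ⊥-elim (u≢v refl)
  joins⇒between (inj₁ refl , inj₂ refl) _   = inj₁ refl
  joins⇒between (inj₂ refl , inj₁ refl) _   = inj₂ refl
  joins⇒between (inj₂ refl , inj₂ refl) u≢v = ⊥-elim (u≢v refl)

  adjacent⇒between : ∀ {Y a b} → Adjacent (Edges Y) a b → ∃ λ y → y ∈ Y × Between y a b
  adjacent⇒between (inj₁ (y , y∈ , eq)) = y , y∈ , inj₁ eq
  adjacent⇒between (inj₂ (y , y∈ , eq)) = y , y∈ , inj₂ eq

  between⇒adjacent : ∀ {Y y a b} → y ∈ Y → Between y a b → Adjacent (Edges Y) a b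
  between⇒adjacent y∈ (inj₁ eq) = inj₁ (_ , y∈ , eq)
  between⇒adjacent y∈ (inj₂ eq) = inj₂ (_ , y∈ , eq)

  endpoints-distinct : ∀ {x} → x ∈ X → proj₁ (φ x) ≢ proj₂ (φ x)
  endpoints-distinct x∈ eq = F.<-irrefl eq (φ-ordered x∈)

  touches⇒endpoint : ∀ {x u v w} → Joins x u v → u ≢ v → x touches w → w ≡ u ⊎ w ≡ v
  touches⇒endpoint x-uv u≢v x∼w with joins⇒between x-uv u≢v
  ... | inj₁ refl = [ (λ eq → inj₁ (sym eq)) , (λ eq → inj₂ (sym eq)) ]′ x∼w
  ... | inj₂ refl = [ (λ eq → inj₂ (sym eq)) , (λ eq → inj₁ (sym eq)) ]′ x∼w

  avoids : ∀ {a u v w} → Joins a u v → u ≢ v → w ≢ u → w ≢ v → ¬ a touches w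
  avoids a-uv u≢v w≢u w≢v a∼w = [ w≢u , w≢v ]′ (touches⇒endpoint a-uv u≢v a∼w)

  ≢-by-endpoint : ∀ {a b w} → ¬ a touches w → b touches w → a ≢ b
  ≢-by-endpoint a≁w b∼w refl = a≁w b∼w

  ≢-by-edge : ∀ {a u v} → ¬ a touches u → a touches v → u ≢ v
  ≢-by-edge a≁u a∼v refl = a≁u a∼v

  other-end : ∀ {x u} → x ∈ X → x touches u → ∃ λ w → x touches w × w ≢ u
  other-end x∈ (inj₁ refl) = _ , inj₂ refl , λ eq → endpoints-distinct x∈ (sym eq)
  other-end x∈ (inj₂ refl) = _ , inj₁ refl , endpoints-distinct x∈

  joins⇒≡ : ∀ {x y u v} → x ∈ X → y ∈ X → Joins x u v → Joins y u v → u ≢ v → x ≡ y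
  joins⇒≡ x∈ y∈ x-uv y-uv u≢v with joins⇒between x-uv u≢v | joins⇒between y-uv u≢v
  ... | inj₁ φx | inj₁ φy = φ-injective x∈ y∈ (trans φx (sym φy))
  ... | inj₂ φx | inj₂ φy = φ-injective x∈ y∈ (trans φx (sym φy))
  ... | inj₁ refl | inj₂ φy = ⊥-elim (F.<-asym (φ-ordered x∈) (φ≡⇒< y∈ φy))
  ... | inj₂ refl | inj₁ φy = ⊥-elim (F.<-asym (φ-ordered x∈) (φ≡⇒< y∈ φy))

  edge : ∀ {u v} → u ≢ v → ∃ λ x → x ∈ X × Joins x u v
  edge {u} {v} u≢v with F.<-cmp u v
  ... | tri< u<v _ _ = let x , x∈ , φx = φ-surjective u<v in x , x∈ , inj₁ (cong proj₁ φx) , inj₂ (cong proj₂ φx)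
  ... | tri≈ _ u≡v _ = ⊥-elim (u≢v u≡v)
  ... | tri> _ _ v<u = let x , x∈ , φx = φ-surjective v<u in x , x∈ , inj₂ (cong proj₂ φx) , inj₁ (cong proj₁ φx)

  star-acyclic : ∀ {Y j} → (∀ {y} → y ∈ Y → y touches j) → Acyclic (Edges Y)
  star-acyclic {Y} {j} Y∼j (l , c , c-inj , adj , close) with off-centre
    where
    off-centre : ∃ λ t → c t ≢ j
    off-centre with c F.zero F.≟ j
    ... | no c₀≢j  = F.zero , c₀≢j
    ... | yes c₀≡j = F.suc F.zero , λ c₁≡j → 0≢1 (c-inj (trans c₀≡j (sym c₁≡j)))
      where
      0≢1 : F.zero ≢ F.suc F.zero
      0≢1 ()
  ... | t , ct≢j = Cycle.pendant-off-cycle (Edges Y) c-inj adj close t (j , only-j)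
    where
    only-j : ∀ w → Adjacent (Edges Y) (c t) w → w ≡ j
    only-j w t∼w with adjacent⇒between t∼w
    ... | y , y∈ , y-tw = [ (λ ct≡j → ⊥-elim (ct≢j ct≡j)) , (λ w≡j → w≡j) ]′ (between⇒touches y-tw (Y∼j y∈))

  leaf-acyclic : ∀ {Y a j} → Acyclic (Edges Y) → a touches j → (∀ {y} → y ∈ Y → ¬ y touches j) →
    Acyclic (Edges (Y ∪ ⁅ a ⁆))
  leaf-acyclic {Y} {a} {j} acyclic a∼j Y≁j (l , c , c-inj , adj , close) with F.any? (λ t → c t F.≟ j)
  ... | yes (t , refl) = Cycle.pendant-off-cycle (Edges (Y ∪ ⁅ a ⁆)) c-inj adj close t j-pendant
    where
    j-pendant : Pendant (Edges (Y ∪ ⁅ a ⁆)) (c t)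
    j-pendant = let u , a-ju = touches⇒between a∼j in u , λ w j∼w → only-a a-ju (adjacent⇒between j∼w)
      where
      only-a : ∀ {u w} → Between a (c t) u → ∃ (λ y → y ∈ Y ∪ ⁅ a ⁆ × Between y (c t) w) → w ≡ u
      only-a a-ju (y , y∈ , y-jw) with x∈p∪q⁻ Y ⁅ a ⁆ y∈
      ... | inj₁ y∈Y = ⊥-elim (Y≁j y∈Y (proj₁ (between⇒joins y-jw)))
      ... | inj₂ y∈a = between-functional (subst (λ z → Between z (c t) _) (x∈⁅y⁆⇒x≡y a y∈a) y-jw) a-ju
  ... | no j∉c = acyclic (l , c , c-inj , (λ i → into-Y (adj i)) , into-Y close)
    where
    into-Y : ∀ {s t} → Adjacent (Edges (Y ∪ ⁅ a ⁆)) (c s) (c t) → Adjacent (Edges Y) (c s) (c t)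
    into-Y s∼t with adjacent⇒between s∼t
    ... | y , y∈ , y-st with x∈p∪q⁻ Y ⁅ a ⁆ y∈
    ...   | inj₁ y∈Y = between⇒adjacent y∈Y y-st
    ...   | inj₂ y∈a = ⊥-elim ([ (λ cs≡j → j∉c (_ , cs≡j)) , (λ ct≡j → j∉c (_ , ct≡j)) ]′
                         (between⇒touches (subst (λ z → Between z _ _) (x∈⁅y⁆⇒x≡y a y∈a) y-st) a∼j))

  touches? : ∀ x v → Dec (x touches v)
  touches? x v = (proj₁ (φ x) F.≟ v) ⊎-dec (proj₂ (φ x) F.≟ v)

  star-independent : ∀ {Y j} → Y ⊆ X → (∀ {y} → y ∈ Y → y touches j) → Independent M Y
  star-independent Y⊆X Y∼j = acyclic⇒independent Y⊆X (star-acyclic Y∼j)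

  record Triangle (x y z : Fin n) : Set where
    constructor triangle
    field
      {u v w} : Fin m
      u≢v : u ≢ v
      v≢w : v ≢ w
      u≢w : u ≢ w
      x-uv : Joins x u v
      y-vw : Joins y v w
      z-uw : Joins z u w

  swap-joins : ∀ {x u v} → Joins x u v → Joins x v u
  swap-joins (x∼u , x∼v) = x∼v , x∼u

  triangle-rotate : ∀ {x y z} → Triangle x y z → Triangle y z x
  triangle-rotate (triangle u≢v v≢w u≢w x-uv y-vw z-uw) =
    triangle v≢w (≢-sym u≢w) (≢-sym u≢v) y-vw (swap-joins z-uw) (swap-joins x-uv)

  triangle-sides-distinct : ∀ {x y z} → Triangle x y z → x ≢ y
  triangle-sides-distinct (triangle u≢v v≢w u≢w x-uv (_ , y∼w) _) refl =
    [ u≢w ∘ sym , v≢w ∘ sym ]′ (touches⇒endpoint x-uv u≢v y∼w)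

  triangle-cycle : ∀ {x y z} → Triangle x y z → HasCycle (Edges ((⁅ x ⁆ ∪ ⁅ y ⁆) ∪ ⁅ z ⁆))
  triangle-cycle {x} {y} {z} (triangle {u} {v} {w} u≢v v≢w u≢w x-uv y-vw z-uw) =
    0 , c , c-inj ,
    (λ { F.zero → side x-uv u≢v (p⊆p∪q _ (p⊆p∪q ⁅ y ⁆ (x∈⁅x⁆ x)))
       ; (F.suc F.zero) → side y-vw v≢w (p⊆p∪q _ (q⊆p∪q ⁅ x ⁆ _ (x∈⁅x⁆ y))) }) ,
    side (swap-joins z-uw) (≢-sym u≢w) (q⊆p∪q _ _ (x∈⁅x⁆ z))
    where
    c : Fin 3 → Fin m
    c F.zero                 = u
    c (F.suc F.zero)         = v
    c (F.suc (F.suc F.zero)) = w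
    c-inj : Injective _≡_ _≡_ c
    c-inj {F.zero}                 {F.zero}                 _  = refl
    c-inj {F.zero}                 {F.suc F.zero}           eq = ⊥-elim (u≢v eq)
    c-inj {F.zero}                 {F.suc (F.suc F.zero)}   eq = ⊥-elim (u≢w eq)
    c-inj {F.suc F.zero}           {F.zero}                 eq = ⊥-elim (u≢v (sym eq))
    c-inj {F.suc F.zero}           {F.suc F.zero}           _  = refl
    c-inj {F.suc F.zero}           {F.suc (F.suc F.zero)}   eq = ⊥-elim (v≢w eq)
    c-inj {F.suc (F.suc F.zero)}   {F.zero}                 eq = ⊥-elim (u≢w (sym eq))
    c-inj {F.suc (F.suc F.zero)}   {F.suc F.zero}           eq = ⊥-elim (v≢w (sym eq))
    c-inj {F.suc (F.suc F.zero)}   {F.suc (F.suc F.zero)}   _  = refl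
    side : ∀ {e a b} → Joins e a b → a ≢ b → e ∈ (⁅ x ⁆ ∪ ⁅ y ⁆) ∪ ⁅ z ⁆ →
      Adjacent (Edges ((⁅ x ⁆ ∪ ⁅ y ⁆) ∪ ⁅ z ⁆)) a b
    side e-ab a≢b e∈ = between⇒adjacent e∈ (joins⇒between e-ab a≢b)

  module _ (simple : Simple M) where

    ∣triple∣≤3 : ∀ (x y z : Fin n) → ∣ (⁅ x ⁆ ∪ ⁅ y ⁆) ∪ ⁅ z ⁆ ∣ ≤ 3
    ∣triple∣≤3 x y z = begin
      ∣ (⁅ x ⁆ ∪ ⁅ y ⁆) ∪ ⁅ z ⁆ ∣       ≤⟨ ∣p∪q∣≤∣p∣+∣q∣ (⁅ x ⁆ ∪ ⁅ y ⁆) ⁅ z ⁆ ⟩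
      ∣ ⁅ x ⁆ ∪ ⁅ y ⁆ ∣ + ∣ ⁅ z ⁆ ∣     ≤⟨ ℕ.+-monoˡ-≤ ∣ ⁅ z ⁆ ∣ (∣p∪q∣≤∣p∣+∣q∣ ⁅ x ⁆ ⁅ y ⁆) ⟩
      ∣ ⁅ x ⁆ ∣ + ∣ ⁅ y ⁆ ∣ + ∣ ⁅ z ⁆ ∣ ≡⟨ cong₂ _+_ (cong₂ _+_ (∣⁅x⁆∣≡1 x) (∣⁅x⁆∣≡1 y)) (∣⁅x⁆∣≡1 z) ⟩
      3                                 ∎
      where open ℕ.≤-Reasoning

    triangle-dependent : ∀ {x y z} → x ∈ X → y ∈ X → z ∈ X → Triangle x y z → Spans M (⁅ x ⁆ ∪ ⁅ y ⁆) z
    triangle-dependent {x} {y} {z} x∈ y∈ z∈ xyz = ≤⇒spans M (ℕ.≤-pred (begin-strict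
      r T                       <⟨ ℕ.≤∧≢⇒< (r-bound T) dependent ⟩
      ∣ T ∣                     ≤⟨ ∣triple∣≤3 x y z ⟩
      3                         ≡⟨ cong suc (sym (r-pair M simple (triangle-sides-distinct xyz))) ⟩
      suc (r (⁅ x ⁆ ∪ ⁅ y ⁆))  ∎))
      where
      open ℕ.≤-Reasoning
      T = (⁅ x ⁆ ∪ ⁅ y ⁆) ∪ ⁅ z ⁆
      dependent : r T ≢ ∣ T ∣
      dependent T-indep = independent⇒acyclic (∪-⊆ (∪-⊆ (x∈p⇒⁅x⁆⊆p x∈) (x∈p⇒⁅x⁆⊆p y∈)) (x∈p⇒⁅x⁆⊆p z∈))
                            T-indep (triangle-cycle xyz)

    triangle-spans : ∀ {x y z A} → x ∈ X → y ∈ X → z ∈ X → Triangle x y z →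
      Spans M A x → Spans M A y → Spans M A z
    triangle-spans {x} {y} {z} {A} x∈ y∈ z∈ xyz A↝x A↝y = spans-trans M A↝xy (triangle-dependent x∈ y∈ z∈ xyz)
      where
      A↝xy : ∀ {w} → w ∈ ⁅ x ⁆ ∪ ⁅ y ⁆ → Spans M A w
      A↝xy w∈ with x∈p∪q⁻ ⁅ x ⁆ ⁅ y ⁆ w∈
      ... | inj₁ w∈x rewrite x∈⁅y⁆⇒x≡y x w∈x = A↝x
      ... | inj₂ w∈y rewrite x∈⁅y⁆⇒x≡y y w∈y = A↝y

    path₃-spans : ∀ {v₀ v₁ v₂ v₃ b₁ b₂ b₃ x A} → v₀ ≢ v₁ → v₀ ≢ v₂ → v₀ ≢ v₃ → v₁ ≢ v₂ → v₂ ≢ v₃ →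
      b₁ ∈ X → b₂ ∈ X → b₃ ∈ X → x ∈ X →
      Joins b₁ v₀ v₁ → Joins b₂ v₁ v₂ → Joins b₃ v₂ v₃ → Joins x v₀ v₃ →
      Spans M A b₁ → Spans M A b₂ → Spans M A b₃ → Spans M A x
    path₃-spans v₀≢v₁ v₀≢v₂ v₀≢v₃ v₁≢v₂ v₂≢v₃ b₁∈ b₂∈ b₃∈ x∈ b₁-01 b₂-12 b₃-23 x-03 A↝b₁ A↝b₂ A↝b₃
      with edge v₀≢v₂
    ... | y , y∈ , y-02 =
      triangle-spans y∈ b₃∈ x∈ (triangle v₀≢v₂ v₂≢v₃ v₀≢v₃ y-02 b₃-23 x-03)
        (triangle-spans b₁∈ b₂∈ y∈ (triangle v₀≢v₁ v₁≢v₂ v₀≢v₂ b₁-01 b₂-12 y-02) A↝b₁ A↝b₂) A↝b₃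

    private-endpoint⇒3≤r : ∀ {t o₁ o₂ w} → t ∈ X → o₁ ∈ X → o₂ ∈ X → o₁ ≢ o₂ →
      t touches w → ¬ o₁ touches w → ¬ o₂ touches w →
      ∀ {T} → t ∈ T → o₁ ∈ T → o₂ ∈ T → 3 ≤ r T
    private-endpoint⇒3≤r {t} {o₁} {o₂} {w} t∈ o₁∈ o₂∈ o₁≢o₂ t∼w o₁≁w o₂≁w {T} t∈T o₁∈T o₂∈T = begin
      3                ≡⟨ sym (cong suc ∣P∣≡2) ⟩
      suc ∣ P ∣        ≡⟨ sym (x∉p⇒∣p∪⁅x⁆∣≡1+∣p∣ t∉P) ⟩
      ∣ P ∪ ⁅ t ⁆ ∣    ≡⟨ sym (acyclic⇒independent P∪t⊆X (leaf-acyclic P-acyclic t∼w P≁w)) ⟩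
      r (P ∪ ⁅ t ⁆)    ≤⟨ r-mono (∪-⊆ (∪-⊆ (x∈p⇒⁅x⁆⊆p o₁∈T) (x∈p⇒⁅x⁆⊆p o₂∈T)) (x∈p⇒⁅x⁆⊆p t∈T)) ⟩
      r T              ∎
      where
      open ℕ.≤-Reasoning
      P = ⁅ o₁ ⁆ ∪ ⁅ o₂ ⁆
      P⊆X : P ⊆ X
      P⊆X = ∪-⊆ (x∈p⇒⁅x⁆⊆p o₁∈) (x∈p⇒⁅x⁆⊆p o₂∈)
      P∪t⊆X : P ∪ ⁅ t ⁆ ⊆ X
      P∪t⊆X = ∪-⊆ P⊆X (x∈p⇒⁅x⁆⊆p t∈)
      ∣P∣≡2 : ∣ P ∣ ≡ 2
      ∣P∣≡2 = trans (x∉p⇒∣p∪⁅x⁆∣≡1+∣p∣ (x≢y⇒x∉⁅y⁆ (≢-sym o₁≢o₂))) (cong suc (∣⁅x⁆∣≡1 o₁))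
      P-acyclic : Acyclic (Edges P)
      P-acyclic = independent⇒acyclic P⊆X (trans (r-pair M simple o₁≢o₂) (sym ∣P∣≡2))
      P≁w : ∀ {y} → y ∈ P → ¬ y touches w
      P≁w y∈ with x∈p∪q⁻ ⁅ o₁ ⁆ ⁅ o₂ ⁆ y∈
      ... | inj₁ y∈o₁ rewrite x∈⁅y⁆⇒x≡y o₁ y∈o₁ = o₁≁w
      ... | inj₂ y∈o₂ rewrite x∈⁅y⁆⇒x≡y o₂ y∈o₂ = o₂≁w
      t∉P : t ∉ P
      t∉P t∈P = P≁w t∈P t∼w

    endpoint-shared : ∀ {t o₁ o₂ w T} → t ∈ X → o₁ ∈ X → o₂ ∈ X → o₁ ≢ o₂ →
      t ∈ T → o₁ ∈ T → o₂ ∈ T → r T ≤ 2 → t touches w → ¬ o₁ touches w → o₂ touches w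
    endpoint-shared {o₂ = o₂} {w} t∈ o₁∈ o₂∈ o₁≢o₂ t∈T o₁∈T o₂∈T r≤2 t∼w o₁≁w with touches? o₂ w
    ... | yes o₂∼w = o₂∼w
    ... | no o₂≁w  =
      ⊥-elim (3≰2 (ℕ.≤-trans (private-endpoint⇒3≤r t∈ o₁∈ o₂∈ o₁≢o₂ t∼w o₁≁w o₂≁w t∈T o₁∈T o₂∈T) r≤2))
      where
      3≰2 : ¬ 3 ≤ 2
      3≰2 (s≤s (s≤s ()))

    dependent-triple⇒triangle : ∀ {a b x} → a ∈ X → b ∈ X → x ∈ X → a ≢ b → a ≢ x → b ≢ x →
      r ((⁅ a ⁆ ∪ ⁅ b ⁆) ∪ ⁅ x ⁆) ≤ 2 → Triangle a b x
    dependent-triple⇒triangle {a} {b} {x} a∈ b∈ x∈ a≢b a≢x b≢x r≤2 =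
      by-cases (touches? a (proj₁ (φ x))) (touches? a (proj₂ (φ x)))
      where
      x-uv : Joins x (proj₁ (φ x)) (proj₂ (φ x))
      x-uv = inj₁ refl , inj₂ refl
      u≢v = endpoints-distinct x∈
      T = (⁅ a ⁆ ∪ ⁅ b ⁆) ∪ ⁅ x ⁆
      a∈T : a ∈ T
      a∈T = p⊆p∪q _ (p⊆p∪q ⁅ b ⁆ (x∈⁅x⁆ a))
      b∈T : b ∈ T
      b∈T = p⊆p∪q _ (q⊆p∪q ⁅ a ⁆ _ (x∈⁅x⁆ b))
      x∈T : x ∈ T
      x∈T = q⊆p∪q _ _ (x∈⁅x⁆ x)
      x-shared : ∀ {w} → x touches w → ¬ a touches w → b touches w
      x-shared = endpoint-shared x∈ a∈ b∈ a≢b x∈T a∈T b∈T r≤2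
      a-shared : ∀ {w} → a touches w → ¬ x touches w → b touches w
      a-shared = endpoint-shared a∈ x∈ b∈ (≢-sym b≢x) a∈T x∈T b∈T r≤2
      triangle-from : ∀ {u v} → Joins x u v → u ≢ v → a touches u → ¬ a touches v → Triangle a b x
      triangle-from x-uv u≢v a∼u a≁v =
        let w , a∼w , w≢u = other-end a∈ a∼u
            w≢v = ≢-sym (≢-by-edge a≁v a∼w)
        in triangle (≢-sym w≢u) w≢v u≢v (a∼u , a∼w)
             (a-shared a∼w (avoids x-uv u≢v w≢u w≢v) , x-shared (proj₂ x-uv) a≁v) x-uv
      by-cases : Dec (a touches proj₁ (φ x)) → Dec (a touches proj₂ (φ x)) → Triangle a b x
      by-cases (yes a∼u) (yes a∼v) = ⊥-elim (a≢x (joins⇒≡ a∈ x∈ (a∼u , a∼v) x-uv u≢v))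
      by-cases (yes a∼u) (no a≁v)  = triangle-from x-uv u≢v a∼u a≁v
      by-cases (no a≁u)  (yes a∼v) = triangle-from (swap-joins x-uv) (≢-sym u≢v) a∼v a≁u
      by-cases (no a≁u)  (no a≁v)  =
        ⊥-elim (b≢x (joins⇒≡ b∈ x∈ (x-shared (proj₁ x-uv) a≁u , x-shared (proj₂ x-uv) a≁v) x-uv u≢v))

-- Frames of M(K_m) are stars

module Frame (M : Matroid n) (simple : Simple M) (X : Subset n) {d : ℕ}
  (iso : RestrictionIsoCompleteGraph M X (suc d)) (B : Subset n) (frame : IsFrame M X B) where

  open Matroid M
  open CycleMatroid M X iso

  B⊆X : B ⊆ X
  B⊆X = proj₁ (proj₁ frame)

  B-independent : Independent M B
  B-independent = proj₁ (proj₂ (proj₁ frame))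

  B-unspanned : ∀ {x} bs → x ∈ B → All (λ b → b ∈ B × b ≢ x) bs → ¬ Spans M (fromList bs) x
  B-unspanned _ x∈B bs∈B-x bs↝x =
    independent⇒unspanned M B-independent x∈B
      (spans-mono M (fromList⊆ (All.map (λ (b∈ , b≢x) → x∈p∧x≢y⇒x∈p-y b∈ b≢x) bs∈B-x)) bs↝x)

  frame-span : ∀ {x} → x ∈ X → x ∈ B ⊎ ∃₂ λ a a′ → a ∈ B × a′ ∈ B × Triangle a a′ x
  frame-span {x} x∈ with proj₂ frame x x∈
  ... | S , S⊆B , ∣S∣≤2 , S↝x with spanned-by-two M simple ∣S∣≤2 S↝x
  ...   | inj₁ x∈S = inj₁ (S⊆B x∈S)
  ...   | inj₂ (a , a′ , a∈ , a′∈ , a≢a′ , a≢x , a′≢x , r≤2) =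
    inj₂ (a , a′ , S⊆B a∈ , S⊆B a′∈ ,
          dependent-triple⇒triangle simple (B⊆X (S⊆B a∈)) (B⊆X (S⊆B a′∈)) x∈ a≢a′ a≢x a′≢x r≤2)

  record Detour (p q : Fin (suc d)) : Set where
    constructor detour
    field
      {mid}  : Fin (suc d)
      {s s′} : Fin n
      s∈B    : s ∈ B
      s′∈B   : s′ ∈ B
      s-pm   : Joins s p mid
      s′-mq  : Joins s′ mid q
      mid≢p  : mid ≢ p
      mid≢q  : mid ≢ q

  frame-path : ∀ {x p q} → x ∈ X → Joins x p q → p ≢ q → x ∈ B ⊎ Detour p q
  frame-path {x} {p} {q} x∈ x-pq p≢q with frame-span x∈
  ... | inj₁ x∈B = inj₁ x∈B
  ... | inj₂ (a , a′ , a∈ , a′∈ , triangle u≢v v≢w u≢w a-uv a′-vw x-uw)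
    with touches⇒endpoint x-uw u≢w (proj₁ x-pq) | touches⇒endpoint x-uw u≢w (proj₂ x-pq)
  ...   | inj₁ refl | inj₁ refl = ⊥-elim (p≢q refl)
  ...   | inj₁ refl | inj₂ refl = inj₂ (detour a∈ a′∈ a-uv a′-vw (≢-sym u≢v) v≢w)
  ...   | inj₂ refl | inj₁ refl = inj₂ (detour a′∈ a∈ (swap-joins a′-vw) (swap-joins a-uv) v≢w (≢-sym u≢v))
  ...   | inj₂ refl | inj₂ refl = ⊥-elim (p≢q refl)

  detour-triangle : ∀ {x p q} (d : Detour p q) → Joins x p q → p ≢ q → Triangle (Detour.s d) (Detour.s′ d) x
  detour-triangle (detour _ _ s-pm s′-mq mid≢p mid≢q) x-pq p≢q =
    triangle (≢-sym mid≢p) mid≢q p≢q s-pm s′-mq x-pq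

  -- The chord v₀v₃ is spanned by the path, so it is not in B; then its detour v₀ – t – v₃
  -- through B puts an edge of B into the span of other edges of B, wherever t lies.
  no-path₃ : ∀ {v₀ v₁ v₂ v₃ b₁ b₂ b₃} →
    v₀ ≢ v₁ → v₀ ≢ v₂ → v₀ ≢ v₃ → v₁ ≢ v₂ → v₁ ≢ v₃ → v₂ ≢ v₃ → b₁ ∈ B → b₂ ∈ B → b₃ ∈ B →
    Joins b₁ v₀ v₁ → Joins b₂ v₁ v₂ → ¬ Joins b₃ v₂ v₃
  no-path₃ {v₀} {v₁} {v₂} {v₃} {b₁} {b₂} {b₃} v₀≢v₁ v₀≢v₂ v₀≢v₃ v₁≢v₂ v₁≢v₃ v₂≢v₃ b₁∈ b₂∈ b₃∈ b₁-01 b₂-12 b₃-23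
    with edge v₀≢v₃
  ... | x , x∈ , x-03 = by-cases (frame-path x∈ x-03 v₀≢v₃)
    where
    X₁ = B⊆X b₁∈
    X₂ = B⊆X b₂∈
    X₃ = B⊆X b₃∈
    b₁≁v₃ = avoids b₁-01 v₀≢v₁ (≢-sym v₀≢v₃) (≢-sym v₁≢v₃)
    b₂≁v₀ = avoids b₂-12 v₁≢v₂ v₀≢v₁ v₀≢v₂
    b₂≁v₃ = avoids b₂-12 v₁≢v₂ (≢-sym v₁≢v₃) (≢-sym v₂≢v₃)
    b₁≁v₂ = avoids b₁-01 v₀≢v₁ (≢-sym v₀≢v₂) (≢-sym v₁≢v₂)
    b₃≁v₀ = avoids b₃-23 v₂≢v₃ v₀≢v₂ v₀≢v₃
    b₃≁v₁ = avoids b₃-23 v₂≢v₃ v₁≢v₂ v₁≢v₃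
    P = b₁ ∷ b₂ ∷ b₃ ∷ []
    P↝x : Spans M (fromList P) x
    P↝x = path₃-spans simple v₀≢v₁ v₀≢v₂ v₀≢v₃ v₁≢v₂ v₂≢v₃ X₁ X₂ X₃ x∈ b₁-01 b₂-12 b₃-23 x-03
            (fromList-spans M P (here refl)) (fromList-spans M P (there (here refl)))
            (fromList-spans M P (there (there (here refl))))
    by-cases : ¬ (x ∈ B ⊎ Detour v₀ v₃)
    by-cases (inj₁ x∈B) =
      B-unspanned P x∈B
        ( (b₁∈ , ≢-by-endpoint b₁≁v₃ (proj₂ x-03))
        ∷ (b₂∈ , ≢-by-endpoint b₂≁v₀ (proj₁ x-03))
        ∷ (b₃∈ , ≢-by-endpoint b₃≁v₀ (proj₁ x-03)) ∷ [])
        P↝x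
    by-cases (inj₂ d@(detour {t} {s} {s′} s∈ s′∈ s-0t s′-t3 t≢v₀ t≢v₃)) with t F.≟ v₁ | t F.≟ v₂
    ... | yes refl | _ =
      B-unspanned (b₂ ∷ b₃ ∷ []) s′∈
        ((b₂∈ , ≢-by-endpoint b₂≁v₃ (proj₂ s′-t3)) ∷ (b₃∈ , ≢-by-endpoint b₃≁v₁ (proj₁ s′-t3)) ∷ [])
        (triangle-spans simple X₂ X₃ (B⊆X s′∈) (triangle v₁≢v₂ v₂≢v₃ v₁≢v₃ b₂-12 b₃-23 s′-t3)
          (fromList-spans M (b₂ ∷ b₃ ∷ []) (here refl)) (fromList-spans M (b₂ ∷ b₃ ∷ []) (there (here refl))))
    ... | no _ | yes refl =
      B-unspanned (b₁ ∷ b₂ ∷ []) s∈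
        ((b₁∈ , ≢-by-endpoint b₁≁v₂ (proj₂ s-0t)) ∷ (b₂∈ , ≢-by-endpoint b₂≁v₀ (proj₁ s-0t)) ∷ [])
        (triangle-spans simple X₁ X₂ (B⊆X s∈) (triangle v₀≢v₁ v₁≢v₂ v₀≢v₂ b₁-01 b₂-12 s-0t)
          (fromList-spans M (b₁ ∷ b₂ ∷ []) (here refl)) (fromList-spans M (b₁ ∷ b₂ ∷ []) (there (here refl))))
    ... | no t≢v₁ | no t≢v₂ =
      B-unspanned (s ∷ P) s′∈
        ( (s∈ , ≢-by-endpoint (avoids s-0t (≢-sym t≢v₀) (≢-sym v₀≢v₃) (≢-sym t≢v₃)) (proj₂ s′-t3))
        ∷ (b₁∈ , ≢-by-endpoint b₁≁v₃ (proj₂ s′-t3))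
        ∷ (b₂∈ , ≢-by-endpoint b₂≁v₃ (proj₂ s′-t3))
        ∷ (b₃∈ , ≢-by-endpoint (avoids b₃-23 v₂≢v₃ t≢v₂ t≢v₃) (proj₁ s′-t3)) ∷ [])
        (triangle-spans simple x∈ (B⊆X s∈) (B⊆X s′∈)
          (triangle-rotate (triangle-rotate (detour-triangle d x-03 v₀≢v₃)))
          (spans-mono M (fromList-mono {xs = P} there) P↝x) (fromList-spans M (s ∷ P) (here refl)))

  -- Disjoint edges pq and st of B would extend, through qs or its detour, to a path of length 3.
  B-edges-meet : ∀ {b₁ b₂} → b₁ ∈ B → b₂ ∈ B → ∃ λ c → b₁ touches c × b₂ touches c
  B-edges-meet {b₁} {b₂} b₁∈ b₂∈ with touches? b₂ (proj₁ (φ b₁)) | touches? b₂ (proj₂ (φ b₁))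
  ... | yes b₂∼p | _        = _ , inj₁ refl , b₂∼p
  ... | no _     | yes b₂∼q = _ , inj₂ refl , b₂∼q
  ... | no b₂≁p  | no b₂≁q  = ⊥-elim (by-cases (frame-path x∈ x-qs q≢s))
    where
    p = proj₁ (φ b₁)
    q = proj₂ (φ b₁)
    s = proj₁ (φ b₂)
    t = proj₂ (φ b₂)
    b₁-pq : Joins b₁ p q
    b₁-pq = inj₁ refl , inj₂ refl
    b₂-st : Joins b₂ s t
    b₂-st = inj₁ refl , inj₂ refl
    p≢q = endpoints-distinct (B⊆X b₁∈)
    s≢t = endpoints-distinct (B⊆X b₂∈)
    p≢s = ≢-by-edge b₂≁p (proj₁ b₂-st)
    p≢t = ≢-by-edge b₂≁p (proj₂ b₂-st)
    q≢s = ≢-by-edge b₂≁q (proj₁ b₂-st)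
    q≢t = ≢-by-edge b₂≁q (proj₂ b₂-st)
    x = proj₁ (edge q≢s)
    x∈ = proj₁ (proj₂ (edge q≢s))
    x-qs = proj₂ (proj₂ (edge q≢s))
    by-cases : ¬ (x ∈ B ⊎ Detour q s)
    by-cases (inj₁ x∈B) = no-path₃ p≢q p≢s p≢t q≢s q≢t s≢t b₁∈ x∈B b₂∈ b₁-pq x-qs b₂-st
    by-cases (inj₂ (detour {w} a∈ a′∈ a-qw a′-ws w≢q w≢s)) with w F.≟ p | w F.≟ t
    ... | yes refl | _ = no-path₃ (≢-sym p≢q) q≢s q≢t p≢s p≢t s≢t b₁∈ a′∈ b₂∈ (swap-joins b₁-pq) a′-ws b₂-st
    ... | no _ | yes refl = no-path₃ p≢q p≢t p≢s q≢t q≢s (≢-sym s≢t) b₁∈ a∈ b₂∈ b₁-pq a-qw (swap-joins b₂-st)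
    ... | no w≢p | no _ = no-path₃ p≢q (≢-sym w≢p) p≢s (≢-sym w≢q) q≢s w≢s b₁∈ a∈ a′∈ b₁-pq a-qw a′-ws

  frame-is-star : ∃ λ c → ∀ {b} → b ∈ B → b touches c
  frame-is-star with F.any? (_∈? B)
  ... | no B-empty = F.zero , λ b∈ → ⊥-elim (B-empty (_ , b∈))
  ... | yes (b₀ , b₀∈) with F.any? (λ b → (b ∈? B) ×-dec ¬? (b F.≟ b₀))
  ...   | no only-b₀ = proj₁ (φ b₀) , through-b₀
    where
    through-b₀ : ∀ {b} → b ∈ B → b touches proj₁ (φ b₀)
    through-b₀ {b} b∈ with b F.≟ b₀
    ... | yes refl = inj₁ refl
    ... | no b≢b₀  = ⊥-elim (only-b₀ (b , b∈ , b≢b₀))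
  ...   | yes (b₁ , b₁∈ , b₁≢b₀) = c , through-c
    where
    c = proj₁ (B-edges-meet b₀∈ b₁∈)
    b₀∼c = proj₁ (proj₂ (B-edges-meet b₀∈ b₁∈))
    b₁∼c = proj₂ (proj₂ (B-edges-meet b₀∈ b₁∈))
    -- An edge of B missing c would close a triangle with b₀ and b₁.
    through-c : ∀ {b} → b ∈ B → b touches c
    through-c {b} b∈ with touches? b c | B-edges-meet b₀∈ b∈ | B-edges-meet b₁∈ b∈
    ... | yes b∼c | _ | _ = b∼c
    ... | no b≁c | d₀ , b₀∼d₀ , b∼d₀ | d₁ , b₁∼d₁ , b∼d₁ =
      ⊥-elim (B-unspanned (b₀ ∷ b₁ ∷ []) b∈
        ((b₀∈ , ≢-sym (≢-by-endpoint b≁c b₀∼c)) ∷ (b₁∈ , ≢-sym (≢-by-endpoint b≁c b₁∼c)) ∷ [])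
        (triangle-spans simple (B⊆X b₀∈) (B⊆X b₁∈) (B⊆X b∈)
          (triangle d₀≢c (≢-sym d₁≢c) d₀≢d₁ (b₀∼d₀ , b₀∼c) (b₁∼c , b₁∼d₁) (b∼d₀ , b∼d₁))
          (fromList-spans M (b₀ ∷ b₁ ∷ []) (here refl)) (fromList-spans M (b₀ ∷ b₁ ∷ []) (there (here refl)))))
      where
      d₀≢c : d₀ ≢ c
      d₀≢c refl = b≁c b∼d₀
      d₁≢c : d₁ ≢ c
      d₁≢c refl = b≁c b∼d₁
      d₀≢d₁ : d₀ ≢ d₁
      d₀≢d₁ refl = b₁≢b₀ (joins⇒≡ (B⊆X b₁∈) (B⊆X b₀∈) (b₁∼c , b₁∼d₁) (b₀∼c , b₀∼d₀) (≢-sym d₀≢c))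

-- Local-critical elements

module CriticalElements (M : Matroid n) (simple : Simple M) (X B B′ : Subset n)
  (iso : RestrictionIsoCompleteGraph M X (suc (rankM M))) (frame : IsFrame M X B) (B′⊆B : B′ ⊆ B)
  (outside : ∀ x → x ∉ X → LoopIn/ M B′ x ⊎ ∃ λ b → b ∈ B ─ B′ × ParallelIn/ M B′ x b) where

  open Matroid M
  open CycleMatroid M X iso
  open Frame M simple X iso B frame

  edgesAt : Fin (suc (rankM M)) → Subset n
  edgesAt j = ⟦ (λ x → (x ∈? X) ×-dec touches? x j) ⟧

  parallelOutside : Fin n → Subset n
  parallelOutside b = ⟦ (λ x → ¬? (x ∈? X) ×-dec ParallelIn/? M B′ b x) ⟧

  ∈edgesAt : ∀ {x j} → x ∈ X → x touches j → x ∈ edgesAt j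
  ∈edgesAt {j = j} x∈ x∼j = ∈⟦⟧⁺ (λ x → (x ∈? X) ×-dec touches? x j) (x∈ , x∼j)

  edgesAt⁻ : ∀ {x j} → x ∈ edgesAt j → x ∈ X × x touches j
  edgesAt⁻ {j = j} = ∈⟦⟧⁻ (λ x → (x ∈? X) ×-dec touches? x j)

  ∈parallelOutside : ∀ {x b} → x ∉ X → ParallelIn/ M B′ b x → x ∈ parallelOutside b
  ∈parallelOutside {b = b} x∉ b∥x = ∈⟦⟧⁺ (λ x → ¬? (x ∈? X) ×-dec ParallelIn/? M B′ b x) (x∉ , b∥x)

  parallelOutside⁻ : ∀ {x b} → x ∈ parallelOutside b → x ∉ X × ParallelIn/ M B′ b x
  parallelOutside⁻ {b = b} = ∈⟦⟧⁻ (λ x → ¬? (x ∈? X) ×-dec ParallelIn/? M B′ b x)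

  module Centred (c : Fin (suc (rankM M))) (B∼c : ∀ {b} → b ∈ B → b touches c) where

    record Spokes (y : Fin n) : Set where
      constructor spokes
      field
        {p q}  : Fin (suc (rankM M))
        {s s′} : Fin n
        s∈B    : s ∈ B
        s′∈B   : s′ ∈ B
        s-cp   : Joins s c p
        s′-cq  : Joins s′ c q
        y-pq   : Joins y p q
        c≢p    : c ≢ p
        c≢q    : c ≢ q
        p≢q    : p ≢ q

    detour-through-centre : ∀ {p q} (d : Detour p q) → p ≢ q → c ≡ Detour.mid d
    detour-through-centre (detour s∈ s′∈ s-pm s′-mq mid≢p mid≢q) p≢q
      with touches⇒endpoint s-pm (≢-sym mid≢p) (B∼c s∈) | touches⇒endpoint s′-mq mid≢q (B∼c s′∈)
    ... | inj₂ c≡mid | _          = c≡mid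
    ... | inj₁ _     | inj₁ c≡mid = c≡mid
    ... | inj₁ refl  | inj₂ refl  = ⊥-elim (p≢q refl)

    via-centre : ∀ {y} → y ∈ X → y ∈ B ⊎ Spokes y
    via-centre {y} y∈ with frame-path y∈ (inj₁ refl , inj₂ refl) (endpoints-distinct y∈)
    ... | inj₁ y∈B = inj₁ y∈B
    ... | inj₂ d with detour-through-centre d (endpoints-distinct y∈)
    ...   | refl = let open Detour d in
      inj₂ (spokes s∈B s′∈B (swap-joins s-pm) s′-mq (inj₁ refl , inj₂ refl) mid≢p mid≢q (endpoints-distinct y∈))

    spokes-triangle : ∀ {y} (sp : Spokes y) → Triangle (Spokes.s sp) (Spokes.s′ sp) y
    spokes-triangle (spokes _ _ s-cp s′-cq y-pq c≢p c≢q p≢q) =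
      triangle (≢-sym c≢p) c≢q p≢q (swap-joins s-cp) s′-cq y-pq

    record Anchor (e : Fin n) : Set where
      field
        {j}  : Fin (suc (rankM M))
        {b}  : Fin n
        b∈B  : b ∈ B
        b∉B′ : b ∉ B′
        b-cj : Joins b c j
        c≢j  : c ≢ j
        e∈S  : e ∈ edgesAt j ∪ parallelOutside b

    anchor : ∀ {e} → ¬ Spans M B′ e → Anchor e
    anchor {e} B′↛e with e ∈? X
    ... | yes e∈X with via-centre e∈X
    ...   | inj₁ e∈B = let j , e∼j , j≢c = other-end e∈X (B∼c e∈B) in
      record { b∈B = e∈B ; b∉B′ = B′↛e ∘ ∈⇒spans M ; b-cj = B∼c e∈B , e∼j ; c≢j = ≢-sym j≢c
             ; e∈S = p⊆p∪q _ (∈edgesAt e∈X e∼j) }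
    ...   | inj₂ sp@(spokes {s = s} {s′} s∈B s′∈B s-cp s′-cq e-pq c≢p c≢q p≢q) with s ∈? B′ | s′ ∈? B′
    ...     | no s∉B′ | _ =
      record { b∈B = s∈B ; b∉B′ = s∉B′ ; b-cj = s-cp ; c≢j = c≢p ; e∈S = p⊆p∪q _ (∈edgesAt e∈X (proj₁ e-pq)) }
    ...     | yes _ | no s′∉B′ =
      record { b∈B = s′∈B ; b∉B′ = s′∉B′ ; b-cj = s′-cq ; c≢j = c≢q ; e∈S = p⊆p∪q _ (∈edgesAt e∈X (proj₂ e-pq)) }
    ...     | yes s∈B′ | yes s′∈B′ =
      ⊥-elim (B′↛e (triangle-spans simple (B⊆X s∈B) (B⊆X s′∈B) e∈X (spokes-triangle sp)
                                   (∈⇒spans M s∈B′) (∈⇒spans M s′∈B′)))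
    anchor {e} B′↛e | no e∉X with outside e e∉X
    ... | inj₁ loop = ⊥-elim (B′↛e (loop⇒spans M loop))
    ... | inj₂ (b , b∈B─B′ , e∥b) =
      let b∈B = p─q⊆p B B′ b∈B─B′
          j , b∼j , j≢c = other-end (B⊆X b∈B) (B∼c b∈B)
      in record { b∈B = b∈B ; b∉B′ = x∈p─q⇒x∉q b∈B─B′ ; b-cj = B∼c b∈B , b∼j ; c≢j = ≢-sym j≢c
                ; e∈S = q⊆p∪q _ _ (∈parallelOutside e∉X (parallel-sym M e∥b)) }

    module Anchored {e : Fin n} (a : Anchor e) where
      open Anchor a

      G : Subset n
      G = B - b

      S : Subset n
      S = edgesAt j ∪ parallelOutside b

      spoke-at-j : ∀ {b′} → b′ ∈ B → b′ touches j → b′ ≡ b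
      spoke-at-j b′∈ b′∼j = joins⇒≡ (B⊆X b′∈) (B⊆X b∈B) (B∼c b′∈ , b′∼j) b-cj c≢j

      G↝spoke : ∀ {b′} → b′ ∈ B → ¬ b′ touches j → Spans M G b′
      G↝spoke b′∈ b′≁j = ∈⇒spans M (x∈p∧x≢y⇒x∈p-y b′∈ (≢-by-endpoint b′≁j (proj₂ b-cj)))

      B′⊆G : B′ ⊆ G
      B′⊆G x∈ = x∈p∧x≢y⇒x∈p-y (B′⊆B x∈) λ { refl → b∉B′ x∈ }

      X-edge-spanned : ∀ {y} → y ∈ X → ¬ y touches j → Spans M G y
      X-edge-spanned {y} y∈ y≁j with via-centre y∈
      ... | inj₁ y∈B = G↝spoke y∈B y≁j
      ... | inj₂ sp@(spokes s∈B s′∈B s-cp s′-cq y-pq c≢p c≢q p≢q) =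
        triangle-spans simple (B⊆X s∈B) (B⊆X s′∈B) y∈ (spokes-triangle sp)
          (G↝spoke s∈B (avoids s-cp c≢p (≢-sym c≢j) (≢-by-edge y≁j (proj₁ y-pq))))
          (G↝spoke s′∈B (avoids s′-cq c≢q (≢-sym c≢j) (≢-by-edge y≁j (proj₂ y-pq))))

      ∁S-spanned : ∀ {y} → y ∉ S → Spans M G y
      ∁S-spanned {y} y∉S with y ∈? X
      ... | yes y∈X = X-edge-spanned y∈X λ y∼j → y∉S (p⊆p∪q _ (∈edgesAt y∈X y∼j))
      ... | no y∉X with outside y y∉X
      ...   | inj₁ loop = spans-mono M B′⊆G (loop⇒spans M loop)
      ...   | inj₂ (b′ , b′∈B─B′ , y∥b′) =
        spans-mono M (∪-⊆ B′⊆G (x∈p⇒⁅x⁆⊆p (x∈p∧x≢y⇒x∈p-y (p─q⊆p B B′ b′∈B─B′) b′≢b))) (parallel⇒spans M y∥b′)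
        where
        b′≢b : b′ ≢ b
        b′≢b refl = y∉S (q⊆p∪q _ _ (∈parallelOutside y∉X (parallel-sym M y∥b′)))

      G+e↝e : Spans M (G ∪ ⁅ e ⁆) e
      G+e↝e = ∈⇒spans M (q⊆p∪q G ⁅ e ⁆ (x∈⁅x⁆ e))

      G+e↝spoke : ∀ {b′} → b′ ∈ B → ¬ b′ touches j → Spans M (G ∪ ⁅ e ⁆) b′
      G+e↝spoke b′∈ b′≁j = spans-mono M (p⊆p∪q ⁅ e ⁆) (G↝spoke b′∈ b′≁j)

      edge-at-j⇒b-spanned : e ∈ X → e touches j → Spans M (G ∪ ⁅ e ⁆) b
      edge-at-j⇒b-spanned e∈X e∼j with via-centre e∈X
      ... | inj₁ e∈B = subst (Spans M (G ∪ ⁅ e ⁆)) (spoke-at-j e∈B e∼j) G+e↝e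
      ... | inj₂ sp@(spokes s∈B s′∈B s-cp s′-cq e-pq c≢p c≢q p≢q) with touches⇒endpoint e-pq p≢q e∼j
      ...   | inj₁ refl = subst (Spans M (G ∪ ⁅ e ⁆)) (spoke-at-j s∈B (proj₂ s-cp))
        (triangle-spans simple (B⊆X s′∈B) e∈X (B⊆X s∈B) (triangle-rotate (spokes-triangle sp))
          (G+e↝spoke s′∈B (avoids s′-cq c≢q (≢-sym c≢p) p≢q)) G+e↝e)
      ...   | inj₂ refl = subst (Spans M (G ∪ ⁅ e ⁆)) (spoke-at-j s′∈B (proj₂ s′-cq))
        (triangle-spans simple e∈X (B⊆X s∈B) (B⊆X s′∈B) (triangle-rotate (triangle-rotate (spokes-triangle sp)))
          G+e↝e (G+e↝spoke s∈B (avoids s-cp c≢p (≢-sym c≢q) (≢-sym p≢q))))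

      b-spanned : Spans M (G ∪ ⁅ e ⁆) b
      b-spanned with x∈p∪q⁻ (edgesAt j) (parallelOutside b) e∈S
      ... | inj₁ e∈H = let e∈X , e∼j = edgesAt⁻ e∈H in edge-at-j⇒b-spanned e∈X e∼j
      ... | inj₂ e∈O =
        spans-mono M (∪-⊆ (p⊆p∪q ⁅ e ⁆ ∘ B′⊆G) (q⊆p∪q G ⁅ e ⁆)) (parallel⇒spans M (proj₂ (parallelOutside⁻ e∈O)))

      G↛e : ¬ Spans M G e
      G↛e G↝e = independent⇒unspanned M B-independent b∈B (spans-trans M G↝G+e b-spanned)
        where
        G↝G+e : ∀ {w} → w ∈ G ∪ ⁅ e ⁆ → Spans M G w
        G↝G+e w∈ with x∈p∪q⁻ G ⁅ e ⁆ w∈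
        ... | inj₁ w∈G = ∈⇒spans M w∈G
        ... | inj₂ w∈e rewrite x∈⁅y⁆⇒x≡y e w∈e = G↝e

      ∣Z∩S∣≤ : ∀ {k} Z → #ParallelOutside M B′ X b ≤ k → ∣ Z ∩ S ∣ ≤ r Z + k
      ∣Z∩S∣≤ {k} Z few = begin
        ∣ Z ∩ S ∣                                     ≤⟨ p⊆q⇒∣p∣≤∣q∣ Z∩S⊆ ⟩
        ∣ (Z ∩ edgesAt j) ∪ parallelOutside b ∣       ≤⟨ ∣p∪q∣≤∣p∣+∣q∣ (Z ∩ edgesAt j) (parallelOutside b) ⟩
        ∣ Z ∩ edgesAt j ∣ + ∣ parallelOutside b ∣     ≡⟨ cong (_+ _) (sym star-indep) ⟩
        r (Z ∩ edgesAt j) + ∣ parallelOutside b ∣     ≤⟨ ℕ.+-mono-≤ (r-mono (p∩q⊆p Z (edgesAt j))) few ⟩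
        r Z + k                                       ∎
        where
        open ℕ.≤-Reasoning
        Z∩S⊆ : Z ∩ S ⊆ (Z ∩ edgesAt j) ∪ parallelOutside b
        Z∩S⊆ y∈ with x∈p∩q⁻ Z S y∈
        ... | y∈Z , y∈S with x∈p∪q⁻ (edgesAt j) (parallelOutside b) y∈S
        ...   | inj₁ y∈H = p⊆p∪q _ (x∈p∩q⁺ (y∈Z , y∈H))
        ...   | inj₂ y∈O = q⊆p∪q _ _ y∈O
        star-indep : r (Z ∩ edgesAt j) ≡ ∣ Z ∩ edgesAt j ∣
        star-indep = star-independent (λ y∈ → proj₁ (edgesAt⁻ (proj₂ (x∈p∩q⁻ Z _ y∈))))
                                      (λ y∈ → proj₂ (edgesAt⁻ (proj₂ (x∈p∩q⁻ Z _ y∈))))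

      not-critical : ∀ {k} → #ParallelOutside M B′ X b ≤ k → ¬ LocalCritical M k e
      not-critical {k} few critical = ℕ.<⇒≱ critical (begin
        ε M r Z                                         ≤⟨ ε≤ε/e+∣Z∩S∣ M simple e∈S G↛e ∁S-spanned Z ⟩
        ε M (rc M ⁅ e ⁆) (Z - e) + ∣ Z ∩ S ∣             ≤⟨ ℕ.+-monoʳ-≤ _ (∣Z∩S∣≤ Z few) ⟩
        ε M (rc M ⁅ e ⁆) (Z - e) + (r Z + k)             ∎)
        where
        open ℕ.≤-Reasoning
        Z = longLineUnion M e

    critical⇒spanned : ∀ {k e} → (∀ b → b ∈ B ─ B′ → #ParallelOutside M B′ X b ≤ k) →
      LocalCritical M k e → Spans M B′ e
    critical⇒spanned {e = e} few critical = decidable-stable (spans? M B′ e) λ B′↛e →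
      let open Anchor (anchor B′↛e)
      in Anchored.not-critical (anchor B′↛e) (few _ (x∈p∧x∉q⇒x∈p─q b∈B b∉B′)) critical

lemma2p3 : ∀ (k : ℕ) → 1 ≤ k → ∀ {n} (M : Matroid n) → Simple M →
    ∀ (X B B′ : Subset n) →
    RestrictionIsoCompleteGraph M X (suc (rankM M)) →
    IsFrame M X B →
    B′ ⊆ B →
    (∀ x → x ∉ X → LoopIn/ M B′ x ⊎ (∃ λ b → b ∈ (B ─ B′) × ParallelIn/ M B′ x b)) →
    (∀ b → b ∈ (B ─ B′) →
      #ParallelOutside M B′ X b ≤ k) →
    #LocalCritical M k ≤ ∣ cl M B′ ∣
-- The argument does not need 1 ≤ k.
lemma2p3 k _ M simple X B B′ iso frame B′⊆B outside few =
  p⊆q⇒∣p∣≤∣q∣ λ critical → ∈⟦⟧⁺ (spans? M B′) (critical⇒spanned few (∈⟦⟧⁻ (LocalCritical? M k) critical))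
  where
  open CriticalElements M simple X B B′ iso frame B′⊆B outside
  open Frame M simple X iso B frame using (frame-is-star)
  open Centred (proj₁ frame-is-star) (proj₂ frame-is-star)
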